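{- Let $K$ be a field of characteristic $0$, $k\ge 2$, and $\overline K$ an algebraic closure of $K$. If $F \in K[[x]]$ is rational, then the $k$-Mahler denominator $\mathfrak d_k F$ has no root in $\overline K$ that is a root of unity of order coprime to $k$ (equivalently, no root $\alpha\in\overline K$ that is a root of unity with $\alpha^{k^n}=\alpha$ for some $n\ge1$).
   Context: A rational series $F=P/Q$ ($P,Q\in K[x]$, $Q(0)\ne0$) is $k$-Mahler, i.e. satisfies some equation $P_0(x)F(x)=\sum_{j=1}^n P_j(x)F(x^{k^j})$ with $P_j\in K[x]$, $P_0\neq0$. The polynomials $P_0$ occurring in such equations (together with $0$) form an ideal of $K[x]$; $\mathfrak d_k F$ is its generator whose lowest-degree nonzero coefficient is $1$. -}

module Defs where

open import Level using (Level; _⊔_) renaming (suc to lsuc)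
open import Algebra.Bundles using (CommutativeRing)
open import Algebra.Morphism.Structures using (module RingMorphisms)
open import Data.Nat as ℕ using (ℕ; zero; suc; _∸_; _<_)
open import Data.Nat.Divisibility using (_∣?_; divides)
open import Data.List using (List; []; _∷_)
open import Data.Product using (∃; _×_; _,_)
open import Data.Sum using (_⊎_)
open import Relation.Nullary using (¬_; yes; no)

record Field (c ℓ : Level) : Set (lsuc (c ⊔ ℓ)) where
  field
    commutativeRing : CommutativeRing c ℓ
  open CommutativeRing commutativeRing public
  field
    1≉0     : ¬ (1# ≈ 0#)
    inverse : ∀ x → ¬ (x ≈ 0#) → ∃ λ y → x * y ≈ 1#

module _ {c ℓ : Level} (K : Field c ℓ) where
  open Field K hiding (zero)

  _·ℕ_ : ℕ → Carrier → Carrier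
  zero  ·ℕ x = 0#
  suc n ·ℕ x = x + (n ·ℕ x)

  CharZero : Set ℓ
  CharZero = ∀ n → ¬ ((suc n ·ℕ 1#) ≈ 0#)

  Series : Set c
  Series = ℕ → Carrier

  -- polynomials: coefficient lists (constant term first; trailing zeros allowed)
  Poly : Set c
  Poly = List Carrier

  coeff : Poly → ℕ → Carrier
  coeff []       _       = 0#
  coeff (a ∷ p)  zero    = a
  coeff (a ∷ p)  (suc n) = coeff p n

  sumTo : (ℕ → Carrier) → ℕ → Carrier
  sumTo f zero    = 0#
  sumTo f (suc n) = sumTo f n + f n

  _⊛_ : Poly → Series → Series
  (p ⊛ f) n = sumTo (λ i → coeff p i * f (n ∸ i)) (suc n)

  -- F(x^m) : coefficient of x^n is F_q if n = q·m, else 0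
  dilate : ℕ → Series → Series
  dilate m F n with m ∣? n
  ... | yes (divides q _) = F q
  ... | no _              = 0#

  PolyZero : Poly → Set ℓ
  PolyZero p = ∀ n → coeff p n ≈ 0#

  _∣ₚ_ : Poly → Poly → Set (c ⊔ ℓ)
  d ∣ₚ p = ∃ λ r → ∀ n → coeff p n ≈ (r ⊛ coeff d) n

  IsRational : Series → Set (c ⊔ ℓ)
  IsRational F = ∃ λ P → ∃ λ Q → ¬ (coeff Q 0 ≈ 0#) × (∀ n → (Q ⊛ F) n ≈ coeff P n)

  mahlerRHS : ℕ → Series → List Poly → ℕ → ℕ → Carrier
  mahlerRHS k F []       j m = 0#
  mahlerRHS k F (P ∷ Ps) j m = (P ⊛ dilate (k ℕ.^ j) F) m + mahlerRHS k F Ps (suc j) m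

  -- P₀ F(x) = Σ_{j=1}^n P_j F(x^{k^j}) for some n and P₁,…,Pₙ
  MahlerEquation : ℕ → Series → Poly → Set (c ⊔ ℓ)
  MahlerEquation k F P₀ = ∃ λ (Ps : List Poly) → ∀ m → (P₀ ⊛ F) m ≈ mahlerRHS k F Ps 1 m

  InMahlerIdeal : ℕ → Series → Poly → Set (c ⊔ ℓ)
  InMahlerIdeal k F P₀ = PolyZero P₀ ⊎ (¬ PolyZero P₀ × MahlerEquation k F P₀)

  LowestCoeffOne : Poly → Set ℓ
  LowestCoeffOne d = ∃ λ i → (∀ j → j < i → coeff d j ≈ 0#) × coeff d i ≈ 1#

  IsMahlerDenominator : ℕ → Series → Poly → Set (c ⊔ ℓ)
  IsMahlerDenominator k F d =
    InMahlerIdeal k F d × (∀ P → InMahlerIdeal k F P → d ∣ₚ P) × LowestCoeffOne d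

-- field extension: ring homomorphism K → L
module _ {c ℓ c' ℓ' : Level} (K : Field c ℓ) (L : Field c' ℓ') where
  private
    module K = Field K
    module L = Field L

  IsFieldHom : (K.Carrier → L.Carrier) → Set (c ⊔ ℓ ⊔ ℓ')
  _^L_ : L.Carrier → ℕ → L.Carrier
  α ^L zero  = L.1#
  α ^L suc n = α L.* (α ^L n)

  IsFieldHom ι = RingMorphisms.IsRingHomomorphism K.rawRing L.rawRing ι

  evalMap : (K.Carrier → L.Carrier) → Poly K → L.Carrier → L.Carrier
  evalMap ι []      α = L.0#
  evalMap ι (a ∷ p) α = ι a L.+ (α L.* evalMap ι p α)

-- Write F = P/Q and let N = kⁿ with α^N = α.  In K[x] let g be a gcd of
-- X = Q·P(x^N) and Y = P·Q(x^N), with X = a·g, Y = b·g and u·a + v·b = 1.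
-- Since a·P·Q(x^N) = b·Q·P(x^N), the series satisfies a·F(x) = b·F(x^N), so a lies
-- in the Mahler ideal and 𝔡_k F divides a; it remains to show a(α) ≠ 0.
-- As α^N = α and N ≠ 0 in characteristic 0, x^N − α = (x − α)·s(x) with
-- s(α) = N·α^(N−1) ≠ 0, so every G ∈ L[x] vanishes at α to the same order as G(x^N).
-- Hence X and Y, and after cancelling g also a and b, vanish to the same order at α;
-- since u·a + v·b = 1 they have no common root, so a(α) ≠ 0.  If P = 0, then F = 0
-- and 1 lies in the ideal.

module Submission where

open import Level using (Level; _⊔_)
open import Algebra.Bundles using (CommutativeRing; Semiring)
open import Algebra.Morphism.Structures using (module RingMorphisms)
import Algebra.Properties.Ring as RingProperties
import Algebra.Properties.AbelianGroup as AbelianGroupProperties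
import Algebra.Properties.Group as GroupProperties
import Algebra.Properties.CommutativeSemigroup as CommutativeSemigroupProperties
import Algebra.Solver.CommutativeMonoid as CommutativeMonoidSolver
open import Data.Nat as ℕ using (ℕ; zero; suc; _∸_; _≤_; _<_; z≤n; s≤s)
import Data.Nat.Properties as ℕ
open import Data.List using (List; []; _∷_; map; length; replicate; _++_)
open import Data.Product using (Σ; ∃; _×_; _,_; proj₁; proj₂)
open import Data.Sum using (inj₁; inj₂)
open import Data.Empty using (⊥-elim)
open import Function using (_∘_)
open import Relation.Nullary using (¬_; yes; no)
open import Relation.Nullary.Negation using (¬¬-map; negated-stable)
open import Relation.Nullary.Decidable using (¬¬-excluded-middle)
open import Relation.Binary.PropositionalEquality as ≡ using (_≡_; _≢_)
import Relation.Binary.Reasoning.Setoid as SetoidReasoning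
open import Relation.Binary using (Setoid; IsEquivalence)

open import Defs using (Field; CharZero; Series; Poly; IsRational; IsMahlerDenominator; IsFieldHom; InMahlerIdeal; _^L_; evalMap)

private
  variable
    ℓ₁ ℓ₂ : Level
    A : Set ℓ₁
    B : Set ℓ₂

  -- Equality in a field is undecidable, but the theorem is a negation, so every case
  -- distinction on such an equality is made inside the double-negation monad.
  return : A → ¬ ¬ A
  return x k = k x

  _>>=_ : ¬ ¬ A → (A → ¬ ¬ B) → ¬ ¬ B
  m >>= f = negated-stable (¬¬-map f m)

module FieldProperties {c ℓ} (K : Field c ℓ) where
  open Field K
  open SetoidReasoning setoid
  open import Algebra.Definitions.RawMonoid +-rawMonoid using () renaming (_×_ to _·ℕ_)

  x≉0∧x*y≈0⇒y≈0 : ∀ {x y} → ¬ x ≈ 0# → x * y ≈ 0# → y ≈ 0#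
  x≉0∧x*y≈0⇒y≈0 {x} {y} x≉0 xy≈0 with inverse x x≉0
  ... | x⁻¹ , xx⁻¹≈1 = begin
    y              ≈⟨ *-identityˡ y ⟨
    1# * y         ≈⟨ *-congʳ (trans (sym xx⁻¹≈1) (*-comm x x⁻¹)) ⟩
    (x⁻¹ * x) * y  ≈⟨ *-assoc x⁻¹ x y ⟩
    x⁻¹ * (x * y)  ≈⟨ *-congˡ xy≈0 ⟩
    x⁻¹ * 0#       ≈⟨ zeroʳ x⁻¹ ⟩
    0#             ∎

  x≉0∧y≉0⇒x*y≉0 : ∀ {x y} → ¬ x ≈ 0# → ¬ y ≈ 0# → ¬ x * y ≈ 0#
  x≉0∧y≉0⇒x*y≉0 x≉0 y≉0 xy≈0 = y≉0 (x≉0∧x*y≈0⇒y≈0 x≉0 xy≈0)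

  *-cancelˡ-≉0 : ∀ {x y z} → ¬ x ≈ 0# → x * y ≈ x * z → y ≈ z
  *-cancelˡ-≉0 {x} {y} {z} x≉0 xy≈xz = begin
    y              ≈⟨ +-identityʳ y ⟨
    y + 0#         ≈⟨ +-congˡ (x≉0∧x*y≈0⇒y≈0 x≉0 x[-y+z]≈0) ⟨
    y + (- y + z)  ≈⟨ +-assoc y (- y) z ⟨
    (y - y) + z    ≈⟨ +-congʳ (-‿inverseʳ y) ⟩
    0# + z         ≈⟨ +-identityˡ z ⟩
    z              ∎
    where
    open RingProperties ring using (-‿distribʳ-*)
    x[-y+z]≈0 : x * (- y + z) ≈ 0#
    x[-y+z]≈0 = trans (distribˡ x (- y) z)
      (trans (+-congʳ (trans (sym (-‿distribʳ-* x y)) (-‿cong xy≈xz))) (-‿inverseˡ (x * z)))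

  Defs-·ℕ≡·ℕ : ∀ n x → Defs._·ℕ_ K n x ≡ n ·ℕ x
  Defs-·ℕ≡·ℕ zero    x = ≡.refl
  Defs-·ℕ≡·ℕ (suc n) x = ≡.cong (x +_) (Defs-·ℕ≡·ℕ n x)

  -x≉0 : ∀ {x} → ¬ x ≈ 0# → ¬ - x ≈ 0#
  -x≉0 {x} x≉0 -x≈0 = x≉0 (begin
    x        ≈⟨ +-identityʳ x ⟨
    x + 0#   ≈⟨ +-congˡ -x≈0 ⟨
    x - x    ≈⟨ -‿inverseʳ x ⟩
    0#       ∎)

module Polynomial {c ℓ} (R : CommutativeRing c ℓ) where
  open CommutativeRing R
  module ≈-Reasoning = SetoidReasoning setoid
  open CommutativeSemigroupProperties +-commutativeSemigroup using (interchange)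
  open RingProperties ring using (-‿distribʳ-*)
  open AbelianGroupProperties +-abelianGroup using (⁻¹-∙-comm)
  open import Algebra.Definitions.RawSemiring (Semiring.rawSemiring semiring) using (_^_)

  -0≈0 : - 0# ≈ 0#
  -0≈0 = GroupProperties.ε⁻¹≈ε +-group

  Pol : Set c
  Pol = List Carrier

  coeff : Pol → ℕ → Carrier
  coeff []      _       = 0#
  coeff (a ∷ p) zero    = a
  coeff (a ∷ p) (suc n) = coeff p n

  infix 4 _≋_
  record _≋_ (p q : Pol) : Set ℓ where
    constructor mk≋
    infixl 20 _!_
    field _!_ : ∀ n → coeff p n ≈ coeff q n
  open _≋_ public

  ≋-refl : ∀ {p} → p ≋ p
  ≋-refl = mk≋ λ n → refl

  ≋-sym : ∀ {p q} → p ≋ q → q ≋ p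
  ≋-sym e = mk≋ λ n → sym (e ! n)

  ≋-trans : ∀ {p q r} → p ≋ q → q ≋ r → p ≋ r
  ≋-trans e f = mk≋ λ n → trans (e ! n) (f ! n)

  ≋-isEquivalence : IsEquivalence _≋_
  ≋-isEquivalence = record { refl = ≋-refl ; sym = ≋-sym ; trans = ≋-trans }

  ≋-setoid : Setoid c ℓ
  ≋-setoid = record { isEquivalence = ≋-isEquivalence }

  module ≋-Reasoning = SetoidReasoning ≋-setoid

  ≋-tail : ∀ {a b p q} → (a ∷ p) ≋ (b ∷ q) → p ≋ q
  ≋-tail e = mk≋ λ n → e ! suc n

  ≋[]-tail : ∀ {a p} → (a ∷ p) ≋ [] → p ≋ []
  ≋[]-tail e = mk≋ λ n → e ! suc n

  ∷-cong : ∀ {a b p q} → a ≈ b → p ≋ q → (a ∷ p) ≋ (b ∷ q)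
  ∷-cong a≈b p≋q = mk≋ λ where
    zero    → a≈b
    (suc n) → p≋q ! n

  ∷-≋[] : ∀ {a p} → a ≈ 0# → p ≋ [] → (a ∷ p) ≋ []
  ∷-≋[] a≈0 p≋0 = mk≋ λ where
    zero    → a≈0
    (suc n) → p≋0 ! n

  infixl 6 _+ₚ_
  infixl 7 _*ₚ_
  infixr 7 _·ₚ_
  infix  8 -ₚ_

  _+ₚ_ : Pol → Pol → Pol
  []      +ₚ q       = q
  (a ∷ p) +ₚ []      = a ∷ p
  (a ∷ p) +ₚ (b ∷ q) = (a + b) ∷ (p +ₚ q)

  _·ₚ_ : Carrier → Pol → Pol
  a ·ₚ p = map (a *_) p

  -ₚ_ : Pol → Pol
  -ₚ p = map -_ p

  _*ₚ_ : Pol → Pol → Pol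
  []      *ₚ q = []
  (a ∷ p) *ₚ q = a ·ₚ q +ₚ (0# ∷ p *ₚ q)

  1ₚ : Pol
  1ₚ = 1# ∷ []

  X^_ : ℕ → Pol
  X^ zero  = 1ₚ
  X^ suc n = 0# ∷ X^ n

  coeff-+ₚ : ∀ p q n → coeff (p +ₚ q) n ≈ coeff p n + coeff q n
  coeff-+ₚ []      q       n       = sym (+-identityˡ _)
  coeff-+ₚ (a ∷ p) []      n       = sym (+-identityʳ _)
  coeff-+ₚ (a ∷ p) (b ∷ q) zero    = refl
  coeff-+ₚ (a ∷ p) (b ∷ q) (suc n) = coeff-+ₚ p q n

  coeff-·ₚ : ∀ a p n → coeff (a ·ₚ p) n ≈ a * coeff p n
  coeff-·ₚ a []      n       = sym (zeroʳ a)
  coeff-·ₚ a (b ∷ p) zero    = refl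
  coeff-·ₚ a (b ∷ p) (suc n) = coeff-·ₚ a p n

  coeff-negₚ : ∀ p n → coeff (-ₚ p) n ≈ - coeff p n
  coeff-negₚ []      n       = sym -0≈0
  coeff-negₚ (b ∷ p) zero    = refl
  coeff-negₚ (b ∷ p) (suc n) = coeff-negₚ p n

  +ₚ-cong : ∀ {p p′ q q′} → p ≋ p′ → q ≋ q′ → p +ₚ q ≋ p′ +ₚ q′
  +ₚ-cong {p} {p′} {q} {q′} e f = mk≋ λ n → begin
    coeff (p +ₚ q) n      ≈⟨ coeff-+ₚ p q n ⟩
    coeff p n + coeff q n ≈⟨ +-cong (e ! n) (f ! n) ⟩
    coeff p′ n + coeff q′ n ≈⟨ coeff-+ₚ p′ q′ n ⟨
    coeff (p′ +ₚ q′) n    ∎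
    where open ≈-Reasoning

  +ₚ-congˡ : ∀ p {q q′} → q ≋ q′ → p +ₚ q ≋ p +ₚ q′
  +ₚ-congˡ p = +ₚ-cong (≋-refl {p})

  +ₚ-congʳ : ∀ {p p′} q → p ≋ p′ → p +ₚ q ≋ p′ +ₚ q
  +ₚ-congʳ q e = +ₚ-cong e (≋-refl {q})

  ·ₚ-cong : ∀ {a b p q} → a ≈ b → p ≋ q → a ·ₚ p ≋ b ·ₚ q
  ·ₚ-cong {a} {b} {p} {q} e f = mk≋ λ n →
    trans (coeff-·ₚ a p n) (trans (*-cong e (f ! n)) (sym (coeff-·ₚ b q n)))

  -ₚ-cong : ∀ {p q} → p ≋ q → -ₚ p ≋ -ₚ q
  -ₚ-cong {p} {q} f = mk≋ λ n →
    trans (coeff-negₚ p n) (trans (-‿cong (f ! n)) (sym (coeff-negₚ q n)))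

  +ₚ-assoc : ∀ p q r → (p +ₚ q) +ₚ r ≋ p +ₚ (q +ₚ r)
  +ₚ-assoc p q r = mk≋ λ n → begin
    coeff ((p +ₚ q) +ₚ r) n             ≈⟨ trans (coeff-+ₚ (p +ₚ q) r n) (+-congʳ (coeff-+ₚ p q n)) ⟩
    coeff p n + coeff q n + coeff r n   ≈⟨ +-assoc _ _ _ ⟩
    coeff p n + (coeff q n + coeff r n) ≈⟨ trans (coeff-+ₚ p (q +ₚ r) n) (+-congˡ (coeff-+ₚ q r n)) ⟨
    coeff (p +ₚ (q +ₚ r)) n             ∎
    where open ≈-Reasoning

  +ₚ-comm : ∀ p q → p +ₚ q ≋ q +ₚ p
  +ₚ-comm p q = mk≋ λ n → trans (coeff-+ₚ p q n) (trans (+-comm _ _) (sym (coeff-+ₚ q p n)))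

  +ₚ-identityʳ : ∀ p → p +ₚ [] ≋ p
  +ₚ-identityʳ p = mk≋ λ n → trans (coeff-+ₚ p [] n) (+-identityʳ _)

  -ₚ-inverseˡ : ∀ p → (-ₚ p) +ₚ p ≋ []
  -ₚ-inverseˡ p = mk≋ λ n → trans (coeff-+ₚ (-ₚ p) p n) (trans (+-congʳ (coeff-negₚ p n)) (-‿inverseˡ _))

  -ₚ-inverseʳ : ∀ p → p +ₚ (-ₚ p) ≋ []
  -ₚ-inverseʳ p = mk≋ λ n → trans (coeff-+ₚ p (-ₚ p) n) (trans (+-congˡ (coeff-negₚ p n)) (-‿inverseʳ _))

  +ₚ-interchange : ∀ p q r s → (p +ₚ q) +ₚ (r +ₚ s) ≋ (p +ₚ r) +ₚ (q +ₚ s)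
  +ₚ-interchange p q r s = mk≋ λ n → begin
    coeff ((p +ₚ q) +ₚ (r +ₚ s)) n
      ≈⟨ trans (coeff-+ₚ (p +ₚ q) (r +ₚ s) n) (+-cong (coeff-+ₚ p q n) (coeff-+ₚ r s n)) ⟩
    (coeff p n + coeff q n) + (coeff r n + coeff s n)
      ≈⟨ interchange _ _ _ _ ⟩
    (coeff p n + coeff r n) + (coeff q n + coeff s n)
      ≈⟨ trans (coeff-+ₚ (p +ₚ r) (q +ₚ s) n) (+-cong (coeff-+ₚ p r n) (coeff-+ₚ q s n)) ⟨
    coeff ((p +ₚ r) +ₚ (q +ₚ s)) n ∎
    where open ≈-Reasoning

  ·ₚ-zeroˡ : ∀ {a} p → a ≈ 0# → a ·ₚ p ≋ []
  ·ₚ-zeroˡ {a} p a≈0 = mk≋ λ n → trans (coeff-·ₚ a p n) (trans (*-congʳ a≈0) (zeroˡ _))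

  ·ₚ-zeroʳ : ∀ a {p} → p ≋ [] → a ·ₚ p ≋ []
  ·ₚ-zeroʳ a {p} p≋0 = mk≋ λ n → trans (coeff-·ₚ a p n) (trans (*-congˡ (p≋0 ! n)) (zeroʳ _))

  ·ₚ-distribˡ : ∀ a p q → a ·ₚ (p +ₚ q) ≋ a ·ₚ p +ₚ a ·ₚ q
  ·ₚ-distribˡ a p q = mk≋ λ n → begin
    coeff (a ·ₚ (p +ₚ q)) n
      ≈⟨ trans (coeff-·ₚ a (p +ₚ q) n) (*-congˡ (coeff-+ₚ p q n)) ⟩
    a * (coeff p n + coeff q n)
      ≈⟨ distribˡ _ _ _ ⟩
    a * coeff p n + a * coeff q n
      ≈⟨ trans (coeff-+ₚ (a ·ₚ p) (a ·ₚ q) n) (+-cong (coeff-·ₚ a p n) (coeff-·ₚ a q n)) ⟨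
    coeff (a ·ₚ p +ₚ a ·ₚ q) n ∎
    where open ≈-Reasoning

  ·ₚ-distribʳ : ∀ a b p → (a + b) ·ₚ p ≋ a ·ₚ p +ₚ b ·ₚ p
  ·ₚ-distribʳ a b p = mk≋ λ n → begin
    coeff ((a + b) ·ₚ p) n
      ≈⟨ coeff-·ₚ (a + b) p n ⟩
    (a + b) * coeff p n
      ≈⟨ distribʳ _ _ _ ⟩
    a * coeff p n + b * coeff p n
      ≈⟨ trans (coeff-+ₚ (a ·ₚ p) (b ·ₚ p) n) (+-cong (coeff-·ₚ a p n) (coeff-·ₚ b p n)) ⟨
    coeff (a ·ₚ p +ₚ b ·ₚ p) n ∎
    where open ≈-Reasoning

  ·ₚ-assoc : ∀ a b p → a ·ₚ (b ·ₚ p) ≋ (a * b) ·ₚ p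
  ·ₚ-assoc a b p = mk≋ λ n →
    trans (coeff-·ₚ a (b ·ₚ p) n) (trans (*-congˡ (coeff-·ₚ b p n))
      (trans (sym (*-assoc _ _ _)) (sym (coeff-·ₚ (a * b) p n))))

  ·ₚ-identity : ∀ p → 1# ·ₚ p ≋ p
  ·ₚ-identity p = mk≋ λ n → trans (coeff-·ₚ 1# p n) (*-identityˡ _)

  *ₚ-zeroˡ : ∀ {p} q → p ≋ [] → p *ₚ q ≋ []
  *ₚ-zeroˡ {[]}    q e = ≋-refl
  *ₚ-zeroˡ {a ∷ p} q e = +ₚ-cong (·ₚ-zeroˡ q (e ! 0)) (∷-≋[] refl (*ₚ-zeroˡ q (≋[]-tail e)))

  *ₚ-zeroʳ : ∀ p {q} → q ≋ [] → p *ₚ q ≋ []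
  *ₚ-zeroʳ []      e = ≋-refl
  *ₚ-zeroʳ (a ∷ p) e = +ₚ-cong (·ₚ-zeroʳ a e) (∷-≋[] refl (*ₚ-zeroʳ p e))

  *ₚ-congʳ : ∀ p {q q′} → q ≋ q′ → p *ₚ q ≋ p *ₚ q′
  *ₚ-congʳ []      e = ≋-refl
  *ₚ-congʳ (a ∷ p) e = +ₚ-cong (·ₚ-cong refl e) (∷-cong refl (*ₚ-congʳ p e))

  *ₚ-congˡ : ∀ {p p′} q → p ≋ p′ → p *ₚ q ≋ p′ *ₚ q
  *ₚ-congˡ {[]}    {[]}     q e = ≋-refl
  *ₚ-congˡ {[]}    {b ∷ p′} q e = ≋-sym (*ₚ-zeroˡ q (≋-sym e))
  *ₚ-congˡ {a ∷ p} {[]}     q e = *ₚ-zeroˡ q e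
  *ₚ-congˡ {a ∷ p} {b ∷ p′} q e = +ₚ-cong (·ₚ-cong (e ! 0) ≋-refl) (∷-cong refl (*ₚ-congˡ q (≋-tail e)))

  *ₚ-cong : ∀ {p p′ q q′} → p ≋ p′ → q ≋ q′ → p *ₚ q ≋ p′ *ₚ q′
  *ₚ-cong {p′ = p′} {q = q} e f = ≋-trans (*ₚ-congˡ q e) (*ₚ-congʳ p′ f)

  private
    0∷-+ₚ : ∀ p q → (0# ∷ p) +ₚ (0# ∷ q) ≋ 0# ∷ (p +ₚ q)
    0∷-+ₚ p q = ∷-cong (+-identityʳ 0#) ≋-refl

  *ₚ-distribʳ : ∀ q p p′ → (p +ₚ p′) *ₚ q ≋ p *ₚ q +ₚ p′ *ₚ q
  *ₚ-distribʳ q []      p′       = ≋-refl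
  *ₚ-distribʳ q (a ∷ p) []       = ≋-sym (+ₚ-identityʳ _)
  *ₚ-distribʳ q (a ∷ p) (b ∷ p′) = begin
    (a + b) ·ₚ q +ₚ (0# ∷ (p +ₚ p′) *ₚ q)
      ≈⟨ +ₚ-cong (·ₚ-distribʳ a b q) (∷-cong refl (*ₚ-distribʳ q p p′)) ⟩
    (a ·ₚ q +ₚ b ·ₚ q) +ₚ (0# ∷ p *ₚ q +ₚ p′ *ₚ q)
      ≈⟨ +ₚ-congˡ (a ·ₚ q +ₚ b ·ₚ q) (0∷-+ₚ (p *ₚ q) (p′ *ₚ q)) ⟨
    (a ·ₚ q +ₚ b ·ₚ q) +ₚ ((0# ∷ p *ₚ q) +ₚ (0# ∷ p′ *ₚ q))
      ≈⟨ +ₚ-interchange (a ·ₚ q) (b ·ₚ q) (0# ∷ p *ₚ q) (0# ∷ p′ *ₚ q) ⟩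
    (a ·ₚ q +ₚ (0# ∷ p *ₚ q)) +ₚ (b ·ₚ q +ₚ (0# ∷ p′ *ₚ q)) ∎
    where open ≋-Reasoning

  *ₚ-distribˡ : ∀ p q q′ → p *ₚ (q +ₚ q′) ≋ p *ₚ q +ₚ p *ₚ q′
  *ₚ-distribˡ []      q q′ = ≋-refl
  *ₚ-distribˡ (a ∷ p) q q′ = begin
    a ·ₚ (q +ₚ q′) +ₚ (0# ∷ p *ₚ (q +ₚ q′))
      ≈⟨ +ₚ-cong (·ₚ-distribˡ a q q′) (∷-cong refl (*ₚ-distribˡ p q q′)) ⟩
    (a ·ₚ q +ₚ a ·ₚ q′) +ₚ (0# ∷ p *ₚ q +ₚ p *ₚ q′)
      ≈⟨ +ₚ-congˡ (a ·ₚ q +ₚ a ·ₚ q′) (0∷-+ₚ (p *ₚ q) (p *ₚ q′)) ⟨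
    (a ·ₚ q +ₚ a ·ₚ q′) +ₚ ((0# ∷ p *ₚ q) +ₚ (0# ∷ p *ₚ q′))
      ≈⟨ +ₚ-interchange (a ·ₚ q) (a ·ₚ q′) (0# ∷ p *ₚ q) (0# ∷ p *ₚ q′) ⟩
    (a ·ₚ q +ₚ (0# ∷ p *ₚ q)) +ₚ (a ·ₚ q′ +ₚ (0# ∷ p *ₚ q′)) ∎
    where open ≋-Reasoning

  ·ₚ-*ₚ : ∀ a q r → (a ·ₚ q) *ₚ r ≋ a ·ₚ (q *ₚ r)
  ·ₚ-*ₚ a []      r = ≋-refl
  ·ₚ-*ₚ a (b ∷ q) r = begin
    (a * b) ·ₚ r +ₚ (0# ∷ (a ·ₚ q) *ₚ r)
      ≈⟨ +ₚ-cong (≋-sym (·ₚ-assoc a b r)) (∷-cong (sym (zeroʳ a)) (·ₚ-*ₚ a q r)) ⟩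
    a ·ₚ (b ·ₚ r) +ₚ a ·ₚ (0# ∷ q *ₚ r)
      ≈⟨ ·ₚ-distribˡ a (b ·ₚ r) (0# ∷ q *ₚ r) ⟨
    a ·ₚ (b ·ₚ r +ₚ (0# ∷ q *ₚ r)) ∎
    where open ≋-Reasoning

  0∷-*ₚ : ∀ q r → (0# ∷ q) *ₚ r ≋ 0# ∷ q *ₚ r
  0∷-*ₚ q r = +ₚ-congʳ (0# ∷ q *ₚ r) (·ₚ-zeroˡ r refl)

  *ₚ-assoc : ∀ p q r → (p *ₚ q) *ₚ r ≋ p *ₚ (q *ₚ r)
  *ₚ-assoc []      q r = ≋-refl
  *ₚ-assoc (a ∷ p) q r = begin
    (a ·ₚ q +ₚ (0# ∷ p *ₚ q)) *ₚ r
      ≈⟨ *ₚ-distribʳ r (a ·ₚ q) (0# ∷ p *ₚ q) ⟩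
    (a ·ₚ q) *ₚ r +ₚ (0# ∷ p *ₚ q) *ₚ r
      ≈⟨ +ₚ-cong (·ₚ-*ₚ a q r) (≋-trans (0∷-*ₚ (p *ₚ q) r) (∷-cong refl (*ₚ-assoc p q r))) ⟩
    a ·ₚ (q *ₚ r) +ₚ (0# ∷ p *ₚ (q *ₚ r)) ∎
    where open ≋-Reasoning

  *ₚ-∷ʳ : ∀ p b q → p *ₚ (b ∷ q) ≋ b ·ₚ p +ₚ (0# ∷ p *ₚ q)
  *ₚ-∷ʳ []      b q = ≋-sym (∷-≋[] refl ≋-refl)
  *ₚ-∷ʳ (a ∷ p) b q = begin
    (a * b ∷ a ·ₚ q) +ₚ (0# ∷ p *ₚ (b ∷ q))
      ≈⟨ ∷-cong (+-identityʳ _) (+ₚ-congˡ (a ·ₚ q) (*ₚ-∷ʳ p b q)) ⟩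
    a * b ∷ (a ·ₚ q +ₚ (b ·ₚ p +ₚ (0# ∷ p *ₚ q)))
      ≈⟨ ∷-cong (*-comm a b) swap ⟩
    b * a ∷ (b ·ₚ p +ₚ (a ·ₚ q +ₚ (0# ∷ p *ₚ q)))
      ≈⟨ ∷-cong (sym (+-identityʳ _)) ≋-refl ⟩
    (b * a ∷ b ·ₚ p) +ₚ (0# ∷ a ·ₚ q +ₚ (0# ∷ p *ₚ q)) ∎
    where
    open ≋-Reasoning
    swap : a ·ₚ q +ₚ (b ·ₚ p +ₚ (0# ∷ p *ₚ q)) ≋ b ·ₚ p +ₚ (a ·ₚ q +ₚ (0# ∷ p *ₚ q))
    swap = ≋-trans (≋-sym (+ₚ-assoc (a ·ₚ q) (b ·ₚ p) _))
             (≋-trans (+ₚ-congʳ _ (+ₚ-comm (a ·ₚ q) (b ·ₚ p))) (+ₚ-assoc (b ·ₚ p) (a ·ₚ q) _))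

  *ₚ-comm : ∀ p q → p *ₚ q ≋ q *ₚ p
  *ₚ-comm []      q = ≋-sym (*ₚ-zeroʳ q ≋-refl)
  *ₚ-comm (a ∷ p) q = ≋-trans (+ₚ-congˡ (a ·ₚ q) (∷-cong refl (*ₚ-comm p q))) (≋-sym (*ₚ-∷ʳ q a p))

  *ₚ-identityˡ : ∀ p → 1ₚ *ₚ p ≋ p
  *ₚ-identityˡ p = ≋-trans (+ₚ-cong (·ₚ-identity p) (∷-≋[] refl ≋-refl)) (+ₚ-identityʳ p)

  *ₚ-identityʳ : ∀ p → p *ₚ 1ₚ ≋ p
  *ₚ-identityʳ p = ≋-trans (*ₚ-comm p 1ₚ) (*ₚ-identityˡ p)

  [a]*ₚ : ∀ a q → (a ∷ []) *ₚ q ≋ a ·ₚ q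
  [a]*ₚ a q = ≋-trans (+ₚ-congˡ (a ·ₚ q) (∷-≋[] refl ≋-refl)) (+ₚ-identityʳ (a ·ₚ q))

  polynomialRing : CommutativeRing c ℓ
  polynomialRing = record
    { isCommutativeRing = record
      { isRing = record
        { +-isAbelianGroup = record
          { isGroup = record
            { isMonoid = record
              { isSemigroup = record
                { isMagma = record { isEquivalence = ≋-isEquivalence ; ∙-cong = +ₚ-cong }
                ; assoc = +ₚ-assoc }
              ; identity = (λ p → ≋-refl) , +ₚ-identityʳ }
            ; inverse = -ₚ-inverseˡ , -ₚ-inverseʳ
            ; ⁻¹-cong = -ₚ-cong }
          ; comm = +ₚ-comm }
        ; *-cong = *ₚ-cong
        ; *-assoc = *ₚ-assoc
        ; *-identity = *ₚ-identityˡ , *ₚ-identityʳ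
        ; distrib = *ₚ-distribˡ , *ₚ-distribʳ }
      ; *-comm = *ₚ-comm } }

  coeff₀-*ₚ : ∀ p q → coeff (p *ₚ q) 0 ≈ coeff p 0 * coeff q 0
  coeff₀-*ₚ []      q = sym (zeroˡ _)
  coeff₀-*ₚ (a ∷ p) q = trans (coeff-+ₚ (a ·ₚ q) (0# ∷ p *ₚ q) 0) (trans (+-identityʳ _) (coeff-·ₚ a q 0))

  module +ₚ = CommutativeSemigroupProperties (CommutativeRing.+-commutativeSemigroup polynomialRing)
  module *ₚ = CommutativeSemigroupProperties (CommutativeRing.*-commutativeSemigroup polynomialRing)
  module *ₚ-Solver = CommutativeMonoidSolver (CommutativeRing.*-commutativeMonoid polynomialRing)

  eval : Pol → Carrier → Carrier
  eval []      x = 0#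
  eval (a ∷ p) x = a + x * eval p x

  eval-≋[] : ∀ {p} x → p ≋ [] → eval p x ≈ 0#
  eval-≋[] {[]}    x e = refl
  eval-≋[] {a ∷ p} x e =
    trans (+-cong (e ! 0) (trans (*-congˡ (eval-≋[] x (≋[]-tail e))) (zeroʳ x))) (+-identityˡ 0#)

  eval-cong : ∀ {p q} x → p ≋ q → eval p x ≈ eval q x
  eval-cong {[]}    {[]}    x e = refl
  eval-cong {[]}    {b ∷ q} x e = sym (eval-≋[] x (≋-sym e))
  eval-cong {a ∷ p} {[]}    x e = eval-≋[] x e
  eval-cong {a ∷ p} {b ∷ q} x e = +-cong (e ! 0) (*-congˡ (eval-cong x (≋-tail e)))

  eval-congʳ : ∀ p {x y} → x ≈ y → eval p x ≈ eval p y
  eval-congʳ []      x≈y = refl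
  eval-congʳ (a ∷ p) x≈y = +-congˡ (*-cong x≈y (eval-congʳ p x≈y))

  eval-+ₚ : ∀ p q x → eval (p +ₚ q) x ≈ eval p x + eval q x
  eval-+ₚ []      q       x = sym (+-identityˡ _)
  eval-+ₚ (a ∷ p) []      x = sym (+-identityʳ _)
  eval-+ₚ (a ∷ p) (b ∷ q) x = begin
    (a + b) + x * eval (p +ₚ q) x           ≈⟨ +-congˡ (trans (*-congˡ (eval-+ₚ p q x)) (distribˡ _ _ _)) ⟩
    (a + b) + (x * eval p x + x * eval q x) ≈⟨ interchange _ _ _ _ ⟩
    (a + x * eval p x) + (b + x * eval q x) ∎
    where open ≈-Reasoning

  eval-·ₚ : ∀ a p x → eval (a ·ₚ p) x ≈ a * eval p x
  eval-·ₚ a []      x = sym (zeroʳ a)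
  eval-·ₚ a (b ∷ p) x = begin
    a * b + x * eval (a ·ₚ p) x
      ≈⟨ +-congˡ (*-congˡ (eval-·ₚ a p x)) ⟩
    a * b + x * (a * eval p x)
      ≈⟨ +-congˡ (trans (sym (*-assoc _ _ _)) (trans (*-congʳ (*-comm x a)) (*-assoc _ _ _))) ⟩
    a * b + a * (x * eval p x)
      ≈⟨ distribˡ _ _ _ ⟨
    a * (b + x * eval p x) ∎
    where open ≈-Reasoning

  eval-*ₚ : ∀ p q x → eval (p *ₚ q) x ≈ eval p x * eval q x
  eval-*ₚ []      q x = sym (zeroˡ _)
  eval-*ₚ (a ∷ p) q x = begin
    eval (a ·ₚ q +ₚ (0# ∷ p *ₚ q)) x          ≈⟨ eval-+ₚ (a ·ₚ q) (0# ∷ p *ₚ q) x ⟩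
    eval (a ·ₚ q) x + (0# + x * eval (p *ₚ q) x)
      ≈⟨ +-cong (eval-·ₚ a q x) (trans (+-identityˡ _) (*-congˡ (eval-*ₚ p q x))) ⟩
    a * eval q x + x * (eval p x * eval q x)  ≈⟨ +-congˡ (*-assoc _ _ _) ⟨
    a * eval q x + x * eval p x * eval q x    ≈⟨ distribʳ _ _ _ ⟨
    (a + x * eval p x) * eval q x             ∎
    where open ≈-Reasoning

  eval-negₚ : ∀ p x → eval (-ₚ p) x ≈ - eval p x
  eval-negₚ []      x = sym -0≈0
  eval-negₚ (a ∷ p) x = trans (+-congˡ (trans (*-congˡ (eval-negₚ p x)) (sym (-‿distribʳ-* x (eval p x)))))
                             (⁻¹-∙-comm a (x * eval p x))

  eval-[a] : ∀ a x → eval (a ∷ []) x ≈ a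
  eval-[a] a x = trans (+-congˡ (zeroʳ x)) (+-identityʳ a)

  eval-X^ : ∀ n x → eval (X^ n) x ≈ x ^ n
  eval-X^ zero    x = eval-[a] 1# x
  eval-X^ (suc n) x = trans (+-identityˡ _) (*-congˡ (eval-X^ n x))

  infixl 8 _∘X^_
  _∘X^_ : Pol → ℕ → Pol
  []      ∘X^ N = []
  (a ∷ p) ∘X^ N = (a ∷ []) +ₚ X^ N *ₚ (p ∘X^ N)

  module _ (N : ℕ) where

    ∘X^-≋[] : ∀ {p} → p ≋ [] → p ∘X^ N ≋ []
    ∘X^-≋[] {[]}    e = ≋-refl
    ∘X^-≋[] {a ∷ p} e = +ₚ-cong (∷-≋[] (e ! 0) ≋-refl) (*ₚ-zeroʳ (X^ N) (∘X^-≋[] (≋[]-tail e)))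

    ∘X^-cong : ∀ {p q} → p ≋ q → p ∘X^ N ≋ q ∘X^ N
    ∘X^-cong {[]}    {[]}    e = ≋-refl
    ∘X^-cong {[]}    {b ∷ q} e = ≋-sym (∘X^-≋[] (≋-sym e))
    ∘X^-cong {a ∷ p} {[]}    e = ∘X^-≋[] e
    ∘X^-cong {a ∷ p} {b ∷ q} e = +ₚ-cong (∷-cong (e ! 0) ≋-refl) (*ₚ-congʳ (X^ N) (∘X^-cong (≋-tail e)))

    ∘X^-+ₚ : ∀ p q → (p +ₚ q) ∘X^ N ≋ p ∘X^ N +ₚ q ∘X^ N
    ∘X^-+ₚ []      q       = ≋-refl
    ∘X^-+ₚ (a ∷ p) []      = ≋-sym (+ₚ-identityʳ _)
    ∘X^-+ₚ (a ∷ p) (b ∷ q) = begin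
      (a + b ∷ []) +ₚ X^ N *ₚ (p +ₚ q) ∘X^ N
        ≈⟨ +ₚ-congˡ (a + b ∷ []) (≋-trans (*ₚ-congʳ (X^ N) (∘X^-+ₚ p q)) (*ₚ-distribˡ (X^ N) _ _)) ⟩
      ((a ∷ []) +ₚ (b ∷ [])) +ₚ (X^ N *ₚ p ∘X^ N +ₚ X^ N *ₚ q ∘X^ N)
        ≈⟨ +ₚ-interchange (a ∷ []) (b ∷ []) (X^ N *ₚ p ∘X^ N) (X^ N *ₚ q ∘X^ N) ⟩
      ((a ∷ []) +ₚ X^ N *ₚ p ∘X^ N) +ₚ ((b ∷ []) +ₚ X^ N *ₚ q ∘X^ N) ∎
      where open ≋-Reasoning

    ∘X^-·ₚ : ∀ a p → (a ·ₚ p) ∘X^ N ≋ a ·ₚ p ∘X^ N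
    ∘X^-·ₚ a []      = ≋-refl
    ∘X^-·ₚ a (b ∷ p) = begin
      (a * b ∷ []) +ₚ X^ N *ₚ (a ·ₚ p) ∘X^ N
        ≈⟨ +ₚ-congˡ (a * b ∷ []) (≋-trans (*ₚ-congʳ (X^ N) (∘X^-·ₚ a p)) (x*ₚa·ₚy (X^ N) (p ∘X^ N))) ⟩
      a ·ₚ (b ∷ []) +ₚ a ·ₚ (X^ N *ₚ p ∘X^ N)
        ≈⟨ ·ₚ-distribˡ a (b ∷ []) (X^ N *ₚ p ∘X^ N) ⟨
      a ·ₚ ((b ∷ []) +ₚ X^ N *ₚ p ∘X^ N) ∎
      where
      open ≋-Reasoning
      x*ₚa·ₚy : ∀ x y → x *ₚ (a ·ₚ y) ≋ a ·ₚ (x *ₚ y)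
      x*ₚa·ₚy x y = ≋-trans (*ₚ-comm x (a ·ₚ y)) (≋-trans (·ₚ-*ₚ a y x) (·ₚ-cong refl (*ₚ-comm y x)))

    ∘X^-*ₚ : ∀ p q → (p *ₚ q) ∘X^ N ≋ p ∘X^ N *ₚ q ∘X^ N
    ∘X^-*ₚ []      q = ≋-refl
    ∘X^-*ₚ (a ∷ p) q = begin
      (a ·ₚ q +ₚ (0# ∷ p *ₚ q)) ∘X^ N
        ≈⟨ ∘X^-+ₚ (a ·ₚ q) (0# ∷ p *ₚ q) ⟩
      (a ·ₚ q) ∘X^ N +ₚ ((0# ∷ []) +ₚ X^ N *ₚ (p *ₚ q) ∘X^ N)
        ≈⟨ +ₚ-cong (∘X^-·ₚ a q) (≋-trans (+ₚ-congʳ _ (∷-≋[] refl ≋-refl)) (*ₚ-congʳ (X^ N) (∘X^-*ₚ p q))) ⟩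
      a ·ₚ q ∘X^ N +ₚ X^ N *ₚ (p ∘X^ N *ₚ q ∘X^ N)
        ≈⟨ +ₚ-cong ([a]*ₚ a (q ∘X^ N)) (*ₚ-assoc (X^ N) (p ∘X^ N) (q ∘X^ N)) ⟨
      (a ∷ []) *ₚ q ∘X^ N +ₚ (X^ N *ₚ p ∘X^ N) *ₚ q ∘X^ N
        ≈⟨ *ₚ-distribʳ (q ∘X^ N) (a ∷ []) (X^ N *ₚ p ∘X^ N) ⟨
      ((a ∷ []) +ₚ X^ N *ₚ p ∘X^ N) *ₚ q ∘X^ N ∎
      where open ≋-Reasoning

    eval-∘X^ : ∀ p x → eval (p ∘X^ N) x ≈ eval p (x ^ N)
    eval-∘X^ []      x = refl
    eval-∘X^ (a ∷ p) x = begin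
      eval ((a ∷ []) +ₚ X^ N *ₚ p ∘X^ N) x       ≈⟨ eval-+ₚ (a ∷ []) (X^ N *ₚ p ∘X^ N) x ⟩
      eval (a ∷ []) x + eval (X^ N *ₚ p ∘X^ N) x ≈⟨ +-cong (eval-[a] a x) (eval-*ₚ (X^ N) (p ∘X^ N) x) ⟩
      a + eval (X^ N) x * eval (p ∘X^ N) x      ≈⟨ +-congˡ (*-cong (eval-X^ N x) (eval-∘X^ p x)) ⟩
      a + x ^ N * eval p (x ^ N)                ∎
      where open ≈-Reasoning

module PolynomialMap {c₁ ℓ₁ c₂ ℓ₂} {R₁ : CommutativeRing c₁ ℓ₁} {R₂ : CommutativeRing c₂ ℓ₂}
  {f : CommutativeRing.Carrier R₁ → CommutativeRing.Carrier R₂}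
  (hom : RingMorphisms.IsRingHomomorphism (CommutativeRing.rawRing R₁) (CommutativeRing.rawRing R₂) f)
  where

  private
    module R₁ = CommutativeRing R₁
    module P₁ = Polynomial R₁
  open CommutativeRing R₂
  open Polynomial R₂
  open RingMorphisms.IsRingHomomorphism hom

  mapₚ : P₁.Pol → Pol
  mapₚ = map f

  coeff-mapₚ : ∀ p n → coeff (mapₚ p) n ≈ f (P₁.coeff p n)
  coeff-mapₚ []      n       = sym 0#-homo
  coeff-mapₚ (a ∷ p) zero    = refl
  coeff-mapₚ (a ∷ p) (suc n) = coeff-mapₚ p n

  mapₚ-cong : ∀ {p q} → p P₁.≋ q → mapₚ p ≋ mapₚ q
  mapₚ-cong {p} {q} e = mk≋ λ n →
    trans (coeff-mapₚ p n) (trans (⟦⟧-cong (e P₁.! n)) (sym (coeff-mapₚ q n)))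

  mapₚ-+ₚ : ∀ p q → mapₚ (p P₁.+ₚ q) ≋ mapₚ p +ₚ mapₚ q
  mapₚ-+ₚ p q = mk≋ λ n → begin
    coeff (mapₚ (p P₁.+ₚ q)) n                ≈⟨ coeff-mapₚ (p P₁.+ₚ q) n ⟩
    f (P₁.coeff (p P₁.+ₚ q) n)                ≈⟨ ⟦⟧-cong (P₁.coeff-+ₚ p q n) ⟩
    f (P₁.coeff p n R₁.+ P₁.coeff q n)        ≈⟨ +-homo _ _ ⟩
    f (P₁.coeff p n) + f (P₁.coeff q n)       ≈⟨ +-cong (coeff-mapₚ p n) (coeff-mapₚ q n) ⟨
    coeff (mapₚ p) n + coeff (mapₚ q) n       ≈⟨ coeff-+ₚ (mapₚ p) (mapₚ q) n ⟨
    coeff (mapₚ p +ₚ mapₚ q) n                ∎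
    where open ≈-Reasoning

  mapₚ-·ₚ : ∀ a p → mapₚ (a P₁.·ₚ p) ≋ f a ·ₚ mapₚ p
  mapₚ-·ₚ a p = mk≋ λ n → begin
    coeff (mapₚ (a P₁.·ₚ p)) n                ≈⟨ coeff-mapₚ (a P₁.·ₚ p) n ⟩
    f (P₁.coeff (a P₁.·ₚ p) n)                ≈⟨ ⟦⟧-cong (P₁.coeff-·ₚ a p n) ⟩
    f (a R₁.* P₁.coeff p n)                   ≈⟨ *-homo _ _ ⟩
    f a * f (P₁.coeff p n)                    ≈⟨ *-congˡ (coeff-mapₚ p n) ⟨
    f a * coeff (mapₚ p) n                    ≈⟨ coeff-·ₚ (f a) (mapₚ p) n ⟨
    coeff (f a ·ₚ mapₚ p) n                   ∎
    where open ≈-Reasoning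

  mapₚ-*ₚ : ∀ p q → mapₚ (p P₁.*ₚ q) ≋ mapₚ p *ₚ mapₚ q
  mapₚ-*ₚ []      q = ≋-refl
  mapₚ-*ₚ (a ∷ p) q = ≋-trans (mapₚ-+ₚ (a P₁.·ₚ q) (R₁.0# ∷ p P₁.*ₚ q))
                               (+ₚ-cong (mapₚ-·ₚ a q) (∷-cong 0#-homo (mapₚ-*ₚ p q)))

  mapₚ-X^ : ∀ n → mapₚ (P₁.X^ n) ≋ X^ n
  mapₚ-X^ zero    = ∷-cong 1#-homo ≋-refl
  mapₚ-X^ (suc n) = ∷-cong 0#-homo (mapₚ-X^ n)

  mapₚ-∘X^ : ∀ N p → mapₚ (p P₁.∘X^ N) ≋ mapₚ p ∘X^ N
  mapₚ-∘X^ N []      = ≋-refl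
  mapₚ-∘X^ N (a ∷ p) = ≋-trans (mapₚ-+ₚ (a ∷ []) (P₁.X^ N P₁.*ₚ p P₁.∘X^ N))
    (+ₚ-congˡ (f a ∷ []) (≋-trans (mapₚ-*ₚ (P₁.X^ N) (p P₁.∘X^ N)) (*ₚ-cong (mapₚ-X^ N) (mapₚ-∘X^ N p))))

  eval-mapₚ-1ₚ : ∀ x → eval (mapₚ P₁.1ₚ) x ≈ 1#
  eval-mapₚ-1ₚ x = trans (eval-[a] (f R₁.1#) x) 1#-homo

module PowerSeries {c ℓ} (R : CommutativeRing c ℓ) where
  open CommutativeRing R
  open Polynomial R
  open GroupProperties +-group using (∙-cancelʳ)

  Ser : Set c
  Ser = ℕ → Carrier

  infix 4 _≐_
  _≐_ : Ser → Ser → Set ℓ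
  f ≐ g = ∀ n → f n ≈ g n

  shift : Ser → Ser
  shift f zero    = 0#
  shift f (suc n) = f n

  shift-cong : ∀ {f g} → f ≐ g → shift f ≐ shift g
  shift-cong e zero    = refl
  shift-cong e (suc n) = e n

  infixr 7 _*ₛ_
  _*ₛ_ : Pol → Ser → Ser
  ([]      *ₛ f) n = 0#
  ((a ∷ p) *ₛ f) n = a * f n + shift (p *ₛ f) n

  *ₛ-congˡ : ∀ p {f g} → f ≐ g → p *ₛ f ≐ p *ₛ g
  *ₛ-congˡ []      e n = refl
  *ₛ-congˡ (a ∷ p) e n = +-cong (*-congˡ (e n)) (shift-cong (*ₛ-congˡ p e) n)

  *ₛ-≋[] : ∀ {p} f → p ≋ [] → p *ₛ f ≐ λ _ → 0#
  *ₛ-≋[] {[]}    f e n = refl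
  *ₛ-≋[] {a ∷ p} f e n =
    trans (+-cong (trans (*-congʳ (e ! 0)) (zeroˡ _)) (shift-≐0 n)) (+-identityˡ 0#)
    where
    shift-≐0 : ∀ n → shift (p *ₛ f) n ≈ 0#
    shift-≐0 zero    = refl
    shift-≐0 (suc n) = *ₛ-≋[] f (≋[]-tail e) n

  *ₛ-zeroʳ : ∀ p → p *ₛ (λ _ → 0#) ≐ λ _ → 0#
  *ₛ-zeroʳ []      n       = refl
  *ₛ-zeroʳ (a ∷ p) zero    = trans (+-identityʳ _) (zeroʳ a)
  *ₛ-zeroʳ (a ∷ p) (suc n) = trans (+-cong (zeroʳ a) (*ₛ-zeroʳ p n)) (+-identityʳ 0#)

  *ₛ-congʳ : ∀ {p q} f → p ≋ q → p *ₛ f ≐ q *ₛ f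
  *ₛ-congʳ {[]}    {[]}    f e n = refl
  *ₛ-congʳ {[]}    {b ∷ q} f e n = sym (*ₛ-≋[] f (≋-sym e) n)
  *ₛ-congʳ {a ∷ p} {[]}    f e n = *ₛ-≋[] f e n
  *ₛ-congʳ {a ∷ p} {b ∷ q} f e n = +-cong (*-congʳ (e ! 0)) (shift-cong (*ₛ-congʳ f (≋-tail e)) n)

  *ₛ-+ₚ : ∀ p q f n → ((p +ₚ q) *ₛ f) n ≈ (p *ₛ f) n + (q *ₛ f) n
  *ₛ-+ₚ []      q       f n = sym (+-identityˡ _)
  *ₛ-+ₚ (a ∷ p) []      f n = sym (+-identityʳ _)
  *ₛ-+ₚ (a ∷ p) (b ∷ q) f n = begin
    (a + b) * f n + shift ((p +ₚ q) *ₛ f) n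
      ≈⟨ +-cong (distribʳ (f n) a b) (shift-+ n) ⟩
    (a * f n + b * f n) + (shift (p *ₛ f) n + shift (q *ₛ f) n)
      ≈⟨ interchange _ _ _ _ ⟩
    (a * f n + shift (p *ₛ f) n) + (b * f n + shift (q *ₛ f) n) ∎
    where
    open ≈-Reasoning
    open CommutativeSemigroupProperties +-commutativeSemigroup using (interchange)
    shift-+ : ∀ n → shift ((p +ₚ q) *ₛ f) n ≈ shift (p *ₛ f) n + shift (q *ₛ f) n
    shift-+ zero    = sym (+-identityˡ 0#)
    shift-+ (suc n) = *ₛ-+ₚ p q f n

  *ₛ-·ₚ : ∀ a p f n → ((a ·ₚ p) *ₛ f) n ≈ a * (p *ₛ f) n
  *ₛ-·ₚ a []      f n = sym (zeroʳ a)
  *ₛ-·ₚ a (b ∷ p) f n =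
    trans (+-cong (*-assoc a b (f n)) (shift-· n)) (sym (distribˡ a _ _))
    where
    shift-· : ∀ n → shift ((a ·ₚ p) *ₛ f) n ≈ a * shift (p *ₛ f) n
    shift-· zero    = sym (zeroʳ a)
    shift-· (suc n) = *ₛ-·ₚ a p f n

  0∷-*ₛ : ∀ p f → (0# ∷ p) *ₛ f ≐ shift (p *ₛ f)
  0∷-*ₛ p f n = trans (+-congʳ (zeroˡ (f n))) (+-identityˡ _)

  *ₛ-*ₚ : ∀ p q f → (p *ₚ q) *ₛ f ≐ p *ₛ q *ₛ f
  *ₛ-*ₚ []      q f n = refl
  *ₛ-*ₚ (a ∷ p) q f n = begin
    ((a ·ₚ q +ₚ (0# ∷ p *ₚ q)) *ₛ f) n           ≈⟨ *ₛ-+ₚ (a ·ₚ q) (0# ∷ p *ₚ q) f n ⟩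
    ((a ·ₚ q) *ₛ f) n + ((0# ∷ p *ₚ q) *ₛ f) n
      ≈⟨ +-cong (*ₛ-·ₚ a q f n) (trans (0∷-*ₛ (p *ₚ q) f n) (shift-cong (*ₛ-*ₚ p q f) n)) ⟩
    a * (q *ₛ f) n + shift (p *ₛ q *ₛ f) n      ∎
    where open ≈-Reasoning

  *ₛ-coeff : ∀ p q → p *ₛ coeff q ≐ coeff (p *ₚ q)
  *ₛ-coeff []      q n = refl
  *ₛ-coeff (a ∷ p) q n = begin
    a * coeff q n + shift (p *ₛ coeff q) n           ≈⟨ +-cong (sym (coeff-·ₚ a q n)) (shift-coeff n) ⟩
    coeff (a ·ₚ q) n + coeff (0# ∷ p *ₚ q) n         ≈⟨ coeff-+ₚ (a ·ₚ q) (0# ∷ p *ₚ q) n ⟨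
    coeff (a ·ₚ q +ₚ (0# ∷ p *ₚ q)) n                ∎
    where
    open ≈-Reasoning
    shift-coeff : ∀ n → shift (p *ₛ coeff q) n ≈ coeff (0# ∷ p *ₚ q) n
    shift-coeff zero    = refl
    shift-coeff (suc n) = *ₛ-coeff p q n

  *ₛ-local : ∀ p {f g} n → (∀ j → j ≤ n → f j ≈ g j) → (p *ₛ f) n ≈ (p *ₛ g) n
  *ₛ-local []      n       e = refl
  *ₛ-local (a ∷ p) zero    e = +-congʳ (*-congˡ (e 0 z≤n))
  *ₛ-local (a ∷ p) (suc n) e =
    +-cong (*-congˡ (e (suc n) ℕ.≤-refl)) (*ₛ-local p n (λ j j≤n → e j (ℕ.m≤n⇒m≤1+n j≤n)))

  *ₛ-cancelˡ : ∀ C {f g} → (∀ y z → coeff C 0 * y ≈ coeff C 0 * z → y ≈ z) →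
               C *ₛ f ≐ C *ₛ g → f ≐ g
  *ₛ-cancelˡ []      cancel e n = cancel _ _ (trans (zeroˡ _) (sym (zeroˡ _)))
  *ₛ-cancelˡ (c₀ ∷ C) {f} {g} cancel e n = agree n n ℕ.≤-refl
    where
    agree : ∀ n j → j ≤ n → f j ≈ g j
    agree zero    zero    _ = cancel _ _ (∙-cancelʳ 0# _ _ (e 0))
    agree (suc n) j       j≤1+n with ℕ.m≤n⇒m<n∨m≡n j≤1+n
    ... | inj₁ (s≤s j≤n) = agree n j j≤n
    ... | inj₂ ≡.refl    = cancel _ _ (∙-cancelʳ _ _ _
      (trans (e (suc n)) (+-congˡ (sym (*ₛ-local C n (agree n))))))

  X^-*ₛ-< : ∀ n f {m} → m < n → (X^ n *ₛ f) m ≈ 0#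
  X^-*ₛ-< (suc n) f {zero}  _           = 0∷-*ₛ (X^ n) f 0
  X^-*ₛ-< (suc n) f {suc m} (s≤s m<n)   = trans (0∷-*ₛ (X^ n) f (suc m)) (X^-*ₛ-< n f m<n)

  X^-*ₛ-+ : ∀ n f m → (X^ n *ₛ f) (n ℕ.+ m) ≈ f m
  X^-*ₛ-+ zero    f zero    = trans (+-identityʳ _) (*-identityˡ _)
  X^-*ₛ-+ zero    f (suc m) = trans (+-identityʳ _) (*-identityˡ _)
  X^-*ₛ-+ (suc n) f m = trans (0∷-*ₛ (X^ n) f (suc (n ℕ.+ m))) (X^-*ₛ-+ n f m)

module MahlerOperators {c ℓ} (K : Field c ℓ) where
  open Field K
  open FieldProperties K
  open Polynomial commutativeRing
  open PowerSeries commutativeRing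
  open import Data.Nat.Divisibility using (_∣_; _∣?_; divides; ∣m+n∣m⇒∣n; ∣-refl; _∣0)
  open Defs using (sumTo; _⊛_; dilate)

  coeff≗ : ∀ p n → Defs.coeff K p n ≡ coeff p n
  coeff≗ []      n       = ≡.refl
  coeff≗ (a ∷ p) zero    = ≡.refl
  coeff≗ (a ∷ p) (suc n) = coeff≗ p n

  PolyZero⇒≋[] : ∀ p → Defs.PolyZero K p → p ≋ []
  PolyZero⇒≋[] p z = mk≋ λ n → trans (reflexive (≡.sym (coeff≗ p n))) (z n)

  sumTo-cong : ∀ {h h′} n → (∀ i → h i ≈ h′ i) → sumTo K h n ≈ sumTo K h′ n
  sumTo-cong zero    e = refl
  sumTo-cong (suc n) e = +-cong (sumTo-cong n e) (e n)

  sumTo-suc : ∀ h n → sumTo K h (suc n) ≈ h 0 + sumTo K (λ i → h (suc i)) n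
  sumTo-suc h zero    = trans (+-identityˡ _) (sym (+-identityʳ _))
  sumTo-suc h (suc n) = trans (+-congʳ (sumTo-suc h n)) (+-assoc _ _ _)

  ⊛≈*ₛ : ∀ p f n → (_⊛_ K p f) n ≈ (p *ₛ f) n
  ⊛≈*ₛ []      f n = trans (sumTo-cong (suc n) (λ i → zeroˡ _)) (sumTo-zero (suc n))
    where
    sumTo-zero : ∀ n → sumTo K (λ _ → 0#) n ≈ 0#
    sumTo-zero zero    = refl
    sumTo-zero (suc n) = trans (+-identityʳ _) (sumTo-zero n)
  ⊛≈*ₛ (a ∷ p) f n = trans (sumTo-suc _ n) (+-congˡ (tail n))
    where
    tail : ∀ n → sumTo K (λ i → Defs.coeff K p i * f (n ∸ suc i)) n ≈ shift (p *ₛ f) n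
    tail zero    = refl
    tail (suc n) = ⊛≈*ₛ p f n

  *ₚ-≋[]-cancelˡ : ∀ {Q h} → ¬ coeff Q 0 ≈ 0# → Q *ₚ h ≋ [] → h ≋ []
  *ₚ-≋[]-cancelˡ {Q} {h} Q₀≉0 Qh≋0 = mk≋ (*ₛ-cancelˡ Q (λ _ _ → *-cancelˡ-≉0 Q₀≉0) λ n →
    trans (*ₛ-coeff Q h n) (trans (Qh≋0 ! n) (sym (*ₛ-zeroʳ Q n))))

  ∣ₚ⇒≋*ₚ : ∀ {d p} → Defs._∣ₚ_ K d p → Σ Pol λ r → p ≋ r *ₚ d
  ∣ₚ⇒≋*ₚ {d} {p} (r , p≈r⊛d) = r , mk≋ λ n → begin
    coeff p n                     ≈⟨ reflexive (coeff≗ p n) ⟨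
    Defs.coeff K p n              ≈⟨ p≈r⊛d n ⟩
    (_⊛_ K r (Defs.coeff K d)) n  ≈⟨ ⊛≈*ₛ r (Defs.coeff K d) n ⟩
    (r *ₛ Defs.coeff K d) n       ≈⟨ *ₛ-congˡ r (λ j → reflexive (coeff≗ d j)) n ⟩
    (r *ₛ coeff d) n              ≈⟨ *ₛ-coeff r d n ⟩
    coeff (r *ₚ d) n              ∎
    where open ≈-Reasoning

  module _ (k : ℕ) (F : Defs.Series K) where

    mahlerRHS-single : ∀ b j s m →
      Defs.mahlerRHS K k F (replicate j [] ++ b ∷ []) s m ≈ (b *ₛ dilate K (k ℕ.^ (j ℕ.+ s)) F) m
    mahlerRHS-single b zero    s m = trans (+-identityʳ _) (⊛≈*ₛ b _ m)
    mahlerRHS-single b (suc j) s m = begin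
      (_⊛_ K [] (dilate K (k ℕ.^ s) F)) m + Defs.mahlerRHS K k F (replicate j [] ++ b ∷ []) (suc s) m
        ≈⟨ +-cong (⊛≈*ₛ [] (dilate K (k ℕ.^ s) F) m) (mahlerRHS-single b j (suc s) m) ⟩
      0# + (b *ₛ dilate K (k ℕ.^ (j ℕ.+ suc s)) F) m
        ≈⟨ +-identityˡ _ ⟩
      (b *ₛ dilate K (k ℕ.^ (j ℕ.+ suc s)) F) m
        ≡⟨ ≡.cong (λ e → (b *ₛ dilate K (k ℕ.^ e) F) m) (ℕ.+-suc j s) ⟩
      (b *ₛ dilate K (k ℕ.^ suc (j ℕ.+ s)) F) m ∎
      where open ≈-Reasoning

    mahlerEquation-single : ∀ {a b} n → a *ₛ F ≐ b *ₛ dilate K (k ℕ.^ suc n) F → Defs.MahlerEquation K k F a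
    mahlerEquation-single {a} {b} n aF≐bF[xᴺ] = replicate n [] ++ b ∷ [] , λ m → begin
      (_⊛_ K a F) m
        ≈⟨ ⊛≈*ₛ a F m ⟩
      (a *ₛ F) m
        ≈⟨ aF≐bF[xᴺ] m ⟩
      (b *ₛ dilate K (k ℕ.^ suc n) F) m
        ≡⟨ ≡.cong (λ e → (b *ₛ dilate K (k ℕ.^ e) F) m) (ℕ.+-comm 1 n) ⟩
      (b *ₛ dilate K (k ℕ.^ (n ℕ.+ 1)) F) m
        ≈⟨ mahlerRHS-single b n 1 m ⟨
      Defs.mahlerRHS K k F (replicate n [] ++ b ∷ []) 1 m ∎
      where open ≈-Reasoning

    mahlerEquation-1ₚ : F ≐ (λ _ → 0#) → Defs.MahlerEquation K k F 1ₚ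
    mahlerEquation-1ₚ F≐0 = [] , λ m → trans (⊛≈*ₛ 1ₚ F m) (trans (1ₚ*ₛF m) (F≐0 m))
      where
      1ₚ*ₛF : 1ₚ *ₛ F ≐ F
      1ₚ*ₛF zero    = trans (+-identityʳ _) (*-identityˡ _)
      1ₚ*ₛF (suc m) = trans (+-identityʳ _) (*-identityˡ _)

  module _ (N : ℕ) .{{_ : ℕ.NonZero N}} where

    dilate-* : ∀ f q → dilate K N f (q ℕ.* N) ≈ f q
    dilate-* f q with N ∣? q ℕ.* N
    ... | yes (divides q′ eq) = reflexive (≡.cong f (≡.sym (ℕ.*-cancelʳ-≡ q q′ N eq)))
    ... | no N∤qN             = ⊥-elim (N∤qN (divides q ≡.refl))

    dilate-∤ : ∀ f {n} → ¬ N ∣ n → dilate K N f n ≈ 0#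
    dilate-∤ f {n} N∤n with N ∣? n
    ... | yes N∣n = ⊥-elim (N∤n N∣n)
    ... | no _    = refl

    dilate-cong : ∀ {f g} → f ≐ g → dilate K N f ≐ dilate K N g
    dilate-cong {f} {g} e n with N ∣? n
    ... | yes (divides q _) = e q
    ... | no _              = refl

    dilate-linear : ∀ a f g → dilate K N (λ n → a * f n + g n) ≐ λ n → a * dilate K N f n + dilate K N g n
    dilate-linear a f g n with N ∣? n
    ... | yes _ = refl
    ... | no _  = sym (trans (+-identityʳ _) (zeroʳ a))

    X^-*ₛ-dilate : ∀ g → X^ N *ₛ dilate K N g ≐ dilate K N (shift g)
    X^-*ₛ-dilate g n with n ℕ.<? N
    ... | yes n<N = trans (X^-*ₛ-< N _ n<N) (sym (below n<N))
      where
      below : ∀ {n} → n < N → dilate K N (shift g) n ≈ 0#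
      below {n} n<N with N ∣? n
      ... | yes (divides zero    ≡.refl) = refl
      ... | yes (divides (suc q) ≡.refl) = ⊥-elim (ℕ.<⇒≱ n<N (ℕ.m≤m+n N (q ℕ.* N)))
      ... | no _                          = refl
    ... | no n≮N = ≡.subst (λ n → (X^ N *ₛ dilate K N g) n ≈ dilate K N (shift g) n)
                     (ℕ.m+[n∸m]≡n (ℕ.≮⇒≥ n≮N)) (above (n ∸ N))
      where
      above : ∀ m → (X^ N *ₛ dilate K N g) (N ℕ.+ m) ≈ dilate K N (shift g) (N ℕ.+ m)
      above m with N ∣? m
      ... | yes (divides q ≡.refl) =
        trans (X^-*ₛ-+ N _ (q ℕ.* N)) (trans (dilate-* g q) (sym (dilate-* (shift g) (suc q))))
      ... | no N∤m =
        trans (X^-*ₛ-+ N _ m) (trans (dilate-∤ g N∤m) (sym (dilate-∤ (shift g) (N∤m ∘ ∣N+m⇒∣m))))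
        where
        ∣N+m⇒∣m : N ∣ N ℕ.+ m → N ∣ m
        ∣N+m⇒∣m N∣N+m = ∣m+n∣m⇒∣n N∣N+m ∣-refl

    ∘X^-*ₛ-dilate : ∀ p f → (p ∘X^ N) *ₛ dilate K N f ≐ dilate K N (p *ₛ f)
    ∘X^-*ₛ-dilate []      f n with N ∣? n
    ... | yes _ = refl
    ... | no _  = refl
    ∘X^-*ₛ-dilate (a ∷ p) f n = begin
      (((a ∷ []) +ₚ X^ N *ₚ p ∘X^ N) *ₛ dilate K N f) n
        ≈⟨ *ₛ-+ₚ (a ∷ []) (X^ N *ₚ p ∘X^ N) (dilate K N f) n ⟩
      ((a ∷ []) *ₛ dilate K N f) n + ((X^ N *ₚ p ∘X^ N) *ₛ dilate K N f) n
        ≈⟨ +-cong ([a]*ₛ n) (*ₛ-*ₚ (X^ N) (p ∘X^ N) (dilate K N f) n) ⟩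
      a * dilate K N f n + (X^ N *ₛ (p ∘X^ N) *ₛ dilate K N f) n
        ≈⟨ +-congˡ (*ₛ-congˡ (X^ N) (∘X^-*ₛ-dilate p f) n) ⟩
      a * dilate K N f n + (X^ N *ₛ dilate K N (p *ₛ f)) n
        ≈⟨ +-congˡ (X^-*ₛ-dilate (p *ₛ f) n) ⟩
      a * dilate K N f n + dilate K N (shift (p *ₛ f)) n
        ≈⟨ dilate-linear a f (shift (p *ₛ f)) n ⟨
      dilate K N ((a ∷ p) *ₛ f) n ∎
      where
      open ≈-Reasoning
      [a]*ₛ : ∀ n → ((a ∷ []) *ₛ dilate K N f) n ≈ a * dilate K N f n
      [a]*ₛ zero    = +-identityʳ _
      [a]*ₛ (suc n) = +-identityʳ _

    coeff-∘X^ : ∀ p → coeff (p ∘X^ N) ≐ dilate K N (coeff p)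
    coeff-∘X^ p n = begin
      coeff (p ∘X^ N) n                   ≈⟨ coeff-*1ₚ (p ∘X^ N) n ⟨
      ((p ∘X^ N) *ₛ coeff 1ₚ) n           ≈⟨ *ₛ-congˡ (p ∘X^ N) dilate-1ₚ n ⟨
      ((p ∘X^ N) *ₛ dilate K N (coeff 1ₚ)) n ≈⟨ ∘X^-*ₛ-dilate p (coeff 1ₚ) n ⟩
      dilate K N (p *ₛ coeff 1ₚ) n        ≈⟨ dilate-cong (coeff-*1ₚ p) n ⟩
      dilate K N (coeff p) n              ∎
      where
      open ≈-Reasoning
      coeff-*1ₚ : ∀ q → q *ₛ coeff 1ₚ ≐ coeff q
      coeff-*1ₚ q n = trans (*ₛ-coeff q 1ₚ n) (*ₚ-identityʳ q ! n)
      coeff-1ₚ-≢0 : ∀ {n} → n ≢ 0 → coeff 1ₚ n ≈ 0#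
      coeff-1ₚ-≢0 {zero}  n≢0 = ⊥-elim (n≢0 ≡.refl)
      coeff-1ₚ-≢0 {suc n} _   = refl
      dilate-1ₚ : dilate K N (coeff 1ₚ) ≐ coeff 1ₚ
      dilate-1ₚ n with N ∣? n
      ... | yes (divides zero    ≡.refl) = refl
      ... | yes (divides (suc q) ≡.refl) = sym (coeff-1ₚ-≢0 (ℕ.≢-nonZero⁻¹ _ {{ℕ.m*n≢0 (suc q) N}}))
      ... | no N∤n                        = sym (coeff-1ₚ-≢0 {n} λ where ≡.refl → N∤n (N ∣0))

    ∘X^-≋[]⇒≋[] : ∀ p → p ∘X^ N ≋ [] → p ≋ []
    ∘X^-≋[]⇒≋[] p e = mk≋ λ i →
      trans (sym (dilate-* (coeff p) i)) (trans (sym (coeff-∘X^ p (i ℕ.* N))) (e ! (i ℕ.* N)))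

    coeff₀-∘X^ : ∀ p → coeff (p ∘X^ N) 0 ≈ coeff p 0
    coeff₀-∘X^ p = trans (coeff-∘X^ p 0) (dilate-* (coeff p) 0)

    *ₚ∘X^≉[] : ∀ P Q → ¬ P ≋ [] → ¬ coeff Q 0 ≈ 0# → ¬ Q *ₚ P ∘X^ N ≋ []
    *ₚ∘X^≉[] P Q P≉0 Q₀≉0 QP∘≋0 = P≉0 (∘X^-≋[]⇒≋[] P (*ₚ-≋[]-cancelˡ {Q} Q₀≉0 QP∘≋0))

    -- Both sides are multiplied by Q·Q(x^N), which is cancellable as its constant term is Q(0)² ≠ 0.
    functional-equation : ∀ {P Q a b} F → ¬ coeff Q 0 ≈ 0# → Q *ₛ F ≐ coeff P →
      a *ₚ (P *ₚ Q ∘X^ N) ≋ b *ₚ (Q *ₚ P ∘X^ N) → a *ₛ F ≐ b *ₛ dilate K N F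
    functional-equation {P} {Q} {a} {b} F Q₀≉0 QF≐P aY≋bX = *ₛ-cancelˡ C (λ _ _ → *-cancelˡ-≉0 C₀≉0) λ n →
      begin
        (C *ₛ a *ₛ F) n
          ≈⟨ *ₛ-*ₚ C a F n ⟨
        ((C *ₚ a) *ₛ F) n
          ≈⟨ *ₛ-congʳ F (rearrangeˡ) n ⟩
        (((a *ₚ Q∘) *ₚ Q) *ₛ F) n
          ≈⟨ *ₛ-*ₚ (a *ₚ Q∘) Q F n ⟩
        ((a *ₚ Q∘) *ₛ Q *ₛ F) n
          ≈⟨ *ₛ-congˡ (a *ₚ Q∘) QF≐P n ⟩
        ((a *ₚ Q∘) *ₛ coeff P) n
          ≈⟨ *ₛ-coeff (a *ₚ Q∘) P n ⟩
        coeff ((a *ₚ Q∘) *ₚ P) n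
          ≈⟨ aQ∘P≋bQP∘ ! n ⟩
        coeff ((b *ₚ Q) *ₚ P∘) n
          ≈⟨ *ₛ-coeff (b *ₚ Q) P∘ n ⟨
        ((b *ₚ Q) *ₛ coeff P∘) n
          ≈⟨ *ₛ-congˡ (b *ₚ Q) (λ j → trans (coeff-∘X^ P j) (dilate-cong (λ i → sym (QF≐P i)) j)) n ⟩
        ((b *ₚ Q) *ₛ dilate K N (Q *ₛ F)) n
          ≈⟨ *ₛ-congˡ (b *ₚ Q) (∘X^-*ₛ-dilate Q F) n ⟨
        ((b *ₚ Q) *ₛ Q∘ *ₛ dilate K N F) n
          ≈⟨ *ₛ-*ₚ (b *ₚ Q) Q∘ (dilate K N F) n ⟨
        (((b *ₚ Q) *ₚ Q∘) *ₛ dilate K N F) n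
          ≈⟨ *ₛ-congʳ (dilate K N F) rearrangeʳ n ⟩
        ((C *ₚ b) *ₛ dilate K N F) n
          ≈⟨ *ₛ-*ₚ C b (dilate K N F) n ⟩
        (C *ₛ b *ₛ dilate K N F) n ∎
      where
      open ≈-Reasoning
      open *ₚ-Solver using (_⊕_; _⊜_)
      Q∘ = Q ∘X^ N
      P∘ = P ∘X^ N
      C = Q *ₚ Q∘
      C₀≉0 : ¬ coeff C 0 ≈ 0#
      C₀≉0 C₀≈0 = x≉0∧y≉0⇒x*y≉0 Q₀≉0 Q₀≉0
        (trans (*-congˡ (sym (coeff₀-∘X^ Q))) (trans (sym (coeff₀-*ₚ Q Q∘)) C₀≈0))
      rearrangeˡ : C *ₚ a ≋ (a *ₚ Q∘) *ₚ Q
      rearrangeˡ = *ₚ-Solver.solve 3 (λ q q′ a → (q ⊕ q′) ⊕ a ⊜ (a ⊕ q′) ⊕ q) ≋-refl Q Q∘ a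
      rearrangeʳ : (b *ₚ Q) *ₚ Q∘ ≋ C *ₚ b
      rearrangeʳ = *ₚ-Solver.solve 3 (λ q q′ b → (b ⊕ q) ⊕ q′ ⊜ (q ⊕ q′) ⊕ b) ≋-refl Q Q∘ b
      aQ∘P≋bQP∘ : (a *ₚ Q∘) *ₚ P ≋ (b *ₚ Q) *ₚ P∘
      aQ∘P≋bQP∘ = ≋-trans (*ₚ-Solver.solve 3 (λ a q′ p → (a ⊕ q′) ⊕ p ⊜ a ⊕ (p ⊕ q′)) ≋-refl a Q∘ P)
                    (≋-trans aY≋bX (≋-sym (*ₚ-assoc b Q P∘)))

module FactorTheorem {c ℓ} (K : Field c ℓ) (α : Field.Carrier K) where
  open Field K hiding (zero)
  open FieldProperties K
  open Polynomial commutativeRing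
  open CommutativeSemigroupProperties +-commutativeSemigroup using (x∙yz≈y∙xz)
  open RingProperties ring using (-‿distribˡ-*)
  open import Algebra.Definitions.RawSemiring (Semiring.rawSemiring semiring) using (_^_)
  open import Algebra.Properties.Semiring.Mult semiring using (×-comm-*) renaming (_×_ to _·ℕ_)
  open import Algebra.Definitions.RawSemiring (Semiring.rawSemiring (CommutativeRing.semiring polynomialRing)) using ()
    renaming (_^_ to _^ₚ_)

  X-α : Pol
  X-α = - α ∷ 1# ∷ []

  X-α*ₚ : ∀ q → X-α *ₚ q ≋ (0# ∷ q) +ₚ (- α) ·ₚ q
  X-α*ₚ q = ≋-trans (+ₚ-congˡ ((- α) ·ₚ q) (∷-cong refl (≋-trans ([a]*ₚ 1# q) (·ₚ-identity q))))
                    (+ₚ-comm ((- α) ·ₚ q) (0# ∷ q))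

  quotient : Pol → Pol
  quotient []          = []
  quotient (a ∷ [])    = []
  quotient (a ∷ b ∷ p) = eval (b ∷ p) α ∷ quotient (b ∷ p)

  length-quotient : ∀ a p → length (quotient (a ∷ p)) ≡ length p
  length-quotient a []      = ≡.refl
  length-quotient a (b ∷ p) = ≡.cong suc (length-quotient b p)

  division-by-X-α : ∀ p → p ≋ X-α *ₚ quotient p +ₚ (eval p α ∷ [])
  division-by-X-α []          = ≋-sym (+ₚ-cong (*ₚ-zeroʳ X-α ≋-refl) (∷-≋[] refl ≋-refl))
  division-by-X-α (a ∷ [])    =
    ≋-sym (≋-trans (+ₚ-congʳ (eval (a ∷ []) α ∷ []) (*ₚ-zeroʳ X-α ≋-refl)) (∷-cong (eval-[a] a α) ≋-refl))
  division-by-X-α (a ∷ b ∷ p) =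
    ≋-trans (∷-cong head (≋-trans (division-by-X-α (b ∷ p)) tail))
            (≋-sym (+ₚ-congʳ (a + α * r ∷ []) (X-α*ₚ (r ∷ q))))
    where
    q = quotient (b ∷ p)
    r = eval (b ∷ p) α
    head : a ≈ 0# + - α * r + (a + α * r)
    head = sym (begin
      0# + - α * r + (a + α * r) ≈⟨ +-congʳ (+-identityˡ _) ⟩
      - α * r + (a + α * r)      ≈⟨ x∙yz≈y∙xz _ _ _ ⟩
      a + (- α * r + α * r)      ≈⟨ +-congˡ (trans (+-congʳ (sym (-‿distribˡ-* α r))) (-‿inverseˡ _)) ⟩
      a + 0#                     ≈⟨ +-identityʳ a ⟩
      a                          ∎)
      where open ≈-Reasoning
    tail : X-α *ₚ q +ₚ (r ∷ []) ≋ (r ∷ q) +ₚ (- α) ·ₚ q +ₚ []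
    tail = begin
      X-α *ₚ q +ₚ (r ∷ [])
        ≈⟨ +ₚ-congʳ (r ∷ []) (X-α*ₚ q) ⟩
      (0# ∷ q) +ₚ (- α) ·ₚ q +ₚ (r ∷ [])
        ≈⟨ +ₚ.xy∙z≈xz∙y (0# ∷ q) ((- α) ·ₚ q) (r ∷ []) ⟩
      (0# ∷ q) +ₚ (r ∷ []) +ₚ (- α) ·ₚ q
        ≈⟨ +ₚ-congʳ ((- α) ·ₚ q) (∷-cong (+-identityˡ r) (+ₚ-identityʳ q)) ⟩
      (r ∷ q) +ₚ (- α) ·ₚ q
        ≈⟨ +ₚ-identityʳ _ ⟨
      (r ∷ q) +ₚ (- α) ·ₚ q +ₚ [] ∎
      where open ≋-Reasoning

  factor-theorem : ∀ {p} → eval p α ≈ 0# → p ≋ X-α *ₚ quotient p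
  factor-theorem {p} p[α]≈0 =
    ≋-trans (division-by-X-α p) (≋-trans (+ₚ-congˡ _ (∷-≋[] p[α]≈0 ≋-refl)) (+ₚ-identityʳ _))

  root-multiplicity : ∀ n g → length g ≤ n → ¬ g ≋ [] →
    ¬ ¬ (Σ ℕ λ t → Σ Pol λ h → g ≋ X-α ^ₚ t *ₚ h × ¬ eval h α ≈ 0#)
  root-multiplicity n       []      _           g≉0 = ⊥-elim (g≉0 ≋-refl)
  root-multiplicity (suc n) (a ∷ p) (s≤s |p|≤n) g≉0 = do
    yes g[α]≈0 ← ¬¬-excluded-middle {A = eval (a ∷ p) α ≈ 0#}
      where no g[α]≉0 → return (0 , a ∷ p , ≋-sym (*ₚ-identityˡ (a ∷ p)) , g[α]≉0)
    let g≋ = factor-theorem g[α]≈0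
    (t , h , q≋ , h[α]≉0) ← root-multiplicity n (quotient (a ∷ p))
      (≡.subst (_≤ n) (≡.sym (length-quotient a p)) |p|≤n)
      (λ q≋0 → g≉0 (≋-trans g≋ (*ₚ-zeroʳ X-α q≋0)))
    return (suc t , h , ≋-trans g≋ (≋-trans (*ₚ-congʳ X-α q≋) (≋-sym (*ₚ-assoc X-α (X-α ^ₚ t) h))) , h[α]≉0)

  geometric : ℕ → Pol
  geometric zero    = []
  geometric (suc n) = α ^ n ∷ geometric n

  X-α*ₚgeometric : ∀ n → X-α *ₚ geometric n ≋ X^ n +ₚ (- α ^ n ∷ [])
  X-α*ₚgeometric zero    = ≋-trans (*ₚ-zeroʳ X-α ≋-refl) (≋-sym (∷-≋[] (-‿inverseʳ 1#) ≋-refl))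
  X-α*ₚgeometric (suc n) = ≋-trans (X-α*ₚ (α ^ n ∷ s)) (∷-cong head tail)
    where
    s = geometric n
    head : 0# + - α * α ^ n ≈ 0# + - α ^ suc n
    head = +-congˡ (sym (-‿distribˡ-* α (α ^ n)))
    tail : (α ^ n ∷ s) +ₚ (- α) ·ₚ s ≋ X^ n +ₚ []
    tail = begin
      (α ^ n ∷ s) +ₚ (- α) ·ₚ s
        ≈⟨ +ₚ-congʳ ((- α) ·ₚ s) (∷-cong (+-identityˡ (α ^ n)) (+ₚ-identityʳ s)) ⟨
      (0# ∷ s) +ₚ (α ^ n ∷ []) +ₚ (- α) ·ₚ s
        ≈⟨ +ₚ.xy∙z≈xz∙y (0# ∷ s) (α ^ n ∷ []) ((- α) ·ₚ s) ⟩
      (0# ∷ s) +ₚ (- α) ·ₚ s +ₚ (α ^ n ∷ [])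
        ≈⟨ +ₚ-congʳ _ (≋-trans (≋-sym (X-α*ₚ s)) (X-α*ₚgeometric n)) ⟩
      X^ n +ₚ (- α ^ n ∷ []) +ₚ (α ^ n ∷ [])
        ≈⟨ +ₚ-assoc (X^ n) _ _ ⟩
      X^ n +ₚ ((- α ^ n ∷ []) +ₚ (α ^ n ∷ []))
        ≈⟨ +ₚ-congˡ (X^ n) (∷-≋[] (-‿inverseˡ _) ≋-refl) ⟩
      X^ n +ₚ [] ∎
      where open ≋-Reasoning

  eval-geometric : ∀ n → eval (geometric (suc n)) α ≈ suc n ·ℕ α ^ n
  eval-geometric zero    = trans (eval-[a] 1# α) (sym (+-identityʳ 1#))
  eval-geometric (suc n) = +-congˡ (trans (*-congˡ (eval-geometric n)) (×-comm-* (suc n) α (α ^ n)))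

  module _ (α≉0 : ¬ α ≈ 0#) where

    X-α*ₚ-cancel : ∀ {h} → X-α *ₚ h ≋ [] → h ≋ []
    X-α*ₚ-cancel {h} e = mk≋ vanish
      where
      step : ∀ n → coeff (0# ∷ h) n ≈ 0# → coeff h n ≈ 0#
      step n e′ = x≉0∧x*y≈0⇒y≈0 (-x≉0 α≉0) (begin
        - α * coeff h n                        ≈⟨ +-identityˡ _ ⟨
        0# + - α * coeff h n                   ≈⟨ +-congʳ e′ ⟨
        coeff (0# ∷ h) n + - α * coeff h n     ≈⟨ +-congˡ (coeff-·ₚ (- α) h n) ⟨
        coeff (0# ∷ h) n + coeff ((- α) ·ₚ h) n ≈⟨ coeff-+ₚ (0# ∷ h) ((- α) ·ₚ h) n ⟨
        coeff ((0# ∷ h) +ₚ (- α) ·ₚ h) n       ≈⟨ X-α*ₚ h ! n ⟨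
        coeff (X-α *ₚ h) n                     ≈⟨ e ! n ⟩
        0#                                     ∎)
        where open ≈-Reasoning
      vanish : ∀ n → coeff h n ≈ 0#
      vanish zero    = step zero refl
      vanish (suc n) = step (suc n) (vanish n)

    X-α^*ₚ-cancel : ∀ t {h} → X-α ^ₚ t *ₚ h ≋ [] → h ≋ []
    X-α^*ₚ-cancel zero    {h} e = ≋-trans (≋-sym (*ₚ-identityˡ h)) e
    X-α^*ₚ-cancel (suc t) {h} e =
      X-α^*ₚ-cancel t (X-α*ₚ-cancel (≋-trans (≋-sym (*ₚ-assoc X-α (X-α ^ₚ t) h)) e))

    eval-≈0-of-zero-divisor : ∀ w g → w *ₚ g ≋ [] → ¬ g ≋ [] → ¬ ¬ eval w α ≈ 0#
    eval-≈0-of-zero-divisor w g wg≋0 g≉0 = do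
      (t , h , g≋ , h[α]≉0) ← root-multiplicity (length g) g ℕ.≤-refl g≉0
      let wh≋0 : w *ₚ h ≋ []
          wh≋0 = X-α^*ₚ-cancel t (begin
            X-α ^ₚ t *ₚ (w *ₚ h)   ≈⟨ *ₚ.x∙yz≈y∙xz (X-α ^ₚ t) w h ⟩
            w *ₚ (X-α ^ₚ t *ₚ h)   ≈⟨ *ₚ-congʳ w g≋ ⟨
            w *ₚ g                 ≈⟨ wg≋0 ⟩
            []                     ∎)
      return (x≉0∧x*y≈0⇒y≈0 h[α]≉0 (trans (*-comm _ _) (trans (sym (eval-*ₚ w h α)) (eval-≋[] α wh≋0))))
      where open ≋-Reasoning

    *ₚ-cancelʳ-eval : ∀ p q {g} → ¬ g ≋ [] → p *ₚ g ≋ q *ₚ g → ¬ ¬ eval p α ≈ eval q α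
    *ₚ-cancelʳ-eval p q {g} g≉0 pg≋qg = do
      [p-q][α]≈0 ← eval-≈0-of-zero-divisor (p +ₚ -ₚ q) g
        (≋-trans ([y-z]x≈yx-zx g p q) (x≈y⇒x∙y⁻¹≈ε pg≋qg)) g≉0
      return (x∙y⁻¹≈ε⇒x≈y _ _ (trans (sym (trans (eval-+ₚ p (-ₚ q) α) (+-congˡ (eval-negₚ q α)))) [p-q][α]≈0))
      where
      open RingProperties (CommutativeRing.ring polynomialRing) using ([y-z]x≈yx-zx)
      open GroupProperties (CommutativeRing.+-group polynomialRing) using (x≈y⇒x∙y⁻¹≈ε)
      open GroupProperties +-group using (x∙y⁻¹≈ε⇒x≈y)

module LocalAssociation {c ℓ} (K : Field c ℓ) (α : Field.Carrier K) (α≉0 : ¬ Field._≈_ K α (Field.0# K)) where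
  open Field K hiding (zero)
  open FieldProperties K
  open Polynomial commutativeRing
  open FactorTheorem K α
  open import Algebra.Definitions.RawSemiring (Semiring.rawSemiring semiring) using (_^_)
  open import Algebra.Properties.Semiring.Mult semiring using (×-congʳ) renaming (_×_ to _·ℕ_)
  open RingProperties ring using (-‿distribˡ-*; x[y-z]≈xy-xz)

  -- g ∼ h: g/h is a unit of the local ring at α, i.e. g and h vanish to the same order at α.
  infix 4 _∼_
  _∼_ : Pol → Pol → Set (c ⊔ ℓ)
  g ∼ h = Σ Pol λ u → Σ Pol λ v → ¬ eval u α ≈ 0# × ¬ eval v α ≈ 0# × u *ₚ g ≋ v *ₚ h

  eval-1ₚ≉0 : ¬ eval 1ₚ α ≈ 0#
  eval-1ₚ≉0 e = 1≉0 (trans (sym (eval-[a] 1# α)) e)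

  eval-*ₚ≉0 : ∀ u v → ¬ eval u α ≈ 0# → ¬ eval v α ≈ 0# → ¬ eval (u *ₚ v) α ≈ 0#
  eval-*ₚ≉0 u v u≉0 v≉0 uv≈0 = x≉0∧y≉0⇒x*y≉0 u≉0 v≉0 (trans (sym (eval-*ₚ u v α)) uv≈0)

  ∼-refl : ∀ {g} → g ∼ g
  ∼-refl = 1ₚ , 1ₚ , eval-1ₚ≉0 , eval-1ₚ≉0 , ≋-refl

  ∼-sym : ∀ {g h} → g ∼ h → h ∼ g
  ∼-sym (u , v , u≉0 , v≉0 , e) = v , u , v≉0 , u≉0 , ≋-sym e

  ∼-resp-≋ : ∀ {g g′ h h′} → g ≋ g′ → h ≋ h′ → g ∼ h → g′ ∼ h′
  ∼-resp-≋ g≋ h≋ (u , v , u≉0 , v≉0 , e) =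
    u , v , u≉0 , v≉0 , ≋-trans (*ₚ-congʳ u (≋-sym g≋)) (≋-trans e (*ₚ-congʳ v h≋))

  ∼-*ₚ : ∀ {g₁ h₁ g₂ h₂} → g₁ ∼ h₁ → g₂ ∼ h₂ → g₁ *ₚ g₂ ∼ h₁ *ₚ h₂
  ∼-*ₚ {g₁} {h₁} {g₂} {h₂} (u₁ , v₁ , u₁≉0 , v₁≉0 , e₁) (u₂ , v₂ , u₂≉0 , v₂≉0 , e₂) =
    u₁ *ₚ u₂ , v₁ *ₚ v₂ , eval-*ₚ≉0 u₁ u₂ u₁≉0 u₂≉0 , eval-*ₚ≉0 v₁ v₂ v₁≉0 v₂≉0 , (begin
      (u₁ *ₚ u₂) *ₚ (g₁ *ₚ g₂) ≈⟨ *ₚ.interchange u₁ u₂ g₁ g₂ ⟩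
      (u₁ *ₚ g₁) *ₚ (u₂ *ₚ g₂) ≈⟨ *ₚ-cong e₁ e₂ ⟩
      (v₁ *ₚ h₁) *ₚ (v₂ *ₚ h₂) ≈⟨ *ₚ.interchange v₁ h₁ v₂ h₂ ⟩
      (v₁ *ₚ v₂) *ₚ (h₁ *ₚ h₂) ∎)
    where open ≋-Reasoning

  ∼-common-factor : ∀ {a b g} → a *ₚ g ∼ b *ₚ g → ¬ g ≋ [] → eval a α ≈ 0# → ¬ ¬ eval b α ≈ 0#
  ∼-common-factor {a} {b} {g} (u , v , u≉0 , v≉0 , e) g≉0 a[α]≈0 = do
    ua[α]≈vb[α] ← *ₚ-cancelʳ-eval α≉0 (u *ₚ a) (v *ₚ b) g≉0
      (≋-trans (*ₚ-assoc u a g) (≋-trans e (≋-sym (*ₚ-assoc v b g))))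
    return (x≉0∧x*y≈0⇒y≈0 v≉0 (begin
      eval v α * eval b α ≈⟨ eval-*ₚ v b α ⟨
      eval (v *ₚ b) α     ≈⟨ ua[α]≈vb[α] ⟨
      eval (u *ₚ a) α     ≈⟨ eval-*ₚ u a α ⟩
      eval u α * eval a α ≈⟨ *-congˡ a[α]≈0 ⟩
      eval u α * 0#       ≈⟨ zeroʳ _ ⟩
      0#                  ∎))
    where open ≈-Reasoning

  module _ (N′ : ℕ) (αᴺ≈α : α ^ suc N′ ≈ α) (N≉0 : ¬ suc N′ ·ℕ 1# ≈ 0#) where

    -- X^N − α = (X − α)·geometric N, and geometric N takes the value N·α^(N−1) = N ≠ 0 at α.
    X-α∼X-α∘X^ : X-α ∼ X-α ∘X^ suc N′
    X-α∼X-α∘X^ = geometric (suc N′) , 1ₚ , s[α]≉0 , eval-1ₚ≉0 , (begin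
      geometric (suc N′) *ₚ X-α         ≈⟨ *ₚ-comm _ X-α ⟩
      X-α *ₚ geometric (suc N′)         ≈⟨ X-α*ₚgeometric (suc N′) ⟩
      X^ suc N′ +ₚ (- α ^ suc N′ ∷ [])  ≈⟨ +ₚ-congˡ (X^ suc N′) (∷-cong (-‿cong αᴺ≈α) ≋-refl) ⟩
      X^ suc N′ +ₚ (- α ∷ [])           ≈⟨ +ₚ-comm (X^ suc N′) (- α ∷ []) ⟩
      (- α ∷ []) +ₚ X^ suc N′           ≈⟨ +ₚ-congˡ (- α ∷ []) X^N≋X^N*ₚ[1∘X^N] ⟩
      X-α ∘X^ suc N′                    ≈⟨ *ₚ-identityˡ _ ⟨
      1ₚ *ₚ X-α ∘X^ suc N′              ∎)
      where
      open ≋-Reasoning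
      αᴺ′≈1 : α ^ N′ ≈ 1#
      αᴺ′≈1 = *-cancelˡ-≉0 α≉0 (trans αᴺ≈α (sym (*-identityʳ α)))
      s[α]≉0 : ¬ eval (geometric (suc N′)) α ≈ 0#
      s[α]≉0 e = N≉0 (trans (×-congʳ (suc N′) (sym αᴺ′≈1)) (trans (sym (eval-geometric N′)) e))
      X^N≋X^N*ₚ[1∘X^N] : X^ suc N′ ≋ X^ suc N′ *ₚ ((1# ∷ []) ∘X^ suc N′)
      X^N≋X^N*ₚ[1∘X^N] =
        ≋-sym (≋-trans (*ₚ-congʳ (X^ suc N′) (+ₚ-congˡ (1# ∷ []) (*ₚ-zeroʳ (X^ suc N′) ≋-refl))) (*ₚ-identityʳ _))

    ∼-∘X^ : ∀ G → ¬ ¬ G ∼ G ∘X^ suc N′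
    ∼-∘X^ G = bounded (length G) G ℕ.≤-refl
      where
      bounded : ∀ n G → length G ≤ n → ¬ ¬ G ∼ G ∘X^ suc N′
      bounded _       []      _           = return ∼-refl
      bounded (suc n) (a ∷ p) (s≤s |p|≤n) = do
        yes G[α]≈0 ← ¬¬-excluded-middle {A = eval (a ∷ p) α ≈ 0#}
          where no G[α]≉0 → return ((a ∷ p) ∘X^ suc N′ , a ∷ p , G∘X^[α]≉0 G[α]≉0 , G[α]≉0 , *ₚ-comm _ _)
        let q = quotient (a ∷ p)
            G≋ = factor-theorem G[α]≈0
        q∼ ← bounded n q (≡.subst (_≤ n) (≡.sym (length-quotient a p)) |p|≤n)
        return (∼-resp-≋ (≋-sym G≋) (≋-trans (≋-sym (∘X^-*ₚ (suc N′) X-α q)) (∘X^-cong (suc N′) (≋-sym G≋)))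
                         (∼-*ₚ X-α∼X-α∘X^ q∼))
        where
        G∘X^[α]≉0 : ¬ eval (a ∷ p) α ≈ 0# → ¬ eval ((a ∷ p) ∘X^ suc N′) α ≈ 0#
        G∘X^[α]≉0 G[α]≉0 G∘X^[α]≈0 = G[α]≉0 (begin
          eval (a ∷ p) α                ≈⟨ eval-congʳ (a ∷ p) αᴺ≈α ⟨
          eval (a ∷ p) (α ^ suc N′)     ≈⟨ eval-∘X^ (suc N′) (a ∷ p) α ⟨
          eval ((a ∷ p) ∘X^ suc N′) α   ≈⟨ G∘X^[α]≈0 ⟩
          0#                            ∎)
          where open ≈-Reasoning

module PolynomialGcd {c ℓ} (K : Field c ℓ) where
  open Field K hiding (zero)
  open Polynomial commutativeRing
  open RingProperties (CommutativeRing.ring polynomialRing) using () renaming (-‿distribˡ-* to -ₚ‿distribˡ-*ₚ)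

  DegreeBelow : Pol → ℕ → Set ℓ
  DegreeBelow p n = ∀ j → n ≤ j → coeff p j ≈ 0#

  DegreeBelow-+ₚ : ∀ p q {n} → DegreeBelow p n → DegreeBelow q n → DegreeBelow (p +ₚ q) n
  DegreeBelow-+ₚ p q dp dq j n≤j = trans (coeff-+ₚ p q j) (trans (+-cong (dp j n≤j) (dq j n≤j)) (+-identityˡ 0#))

  DegreeBelow-·ₚ : ∀ a p {n} → DegreeBelow p n → DegreeBelow (a ·ₚ p) n
  DegreeBelow-·ₚ a p dp j n≤j = trans (coeff-·ₚ a p j) (trans (*-congˡ (dp j n≤j)) (zeroʳ a))

  DegreeBelow-∷ : ∀ a p {n} → DegreeBelow p n → DegreeBelow (a ∷ p) (suc n)
  DegreeBelow-∷ a p dp (suc j) (s≤s n≤j) = dp j n≤j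

  DegreeBelow-pred : ∀ p {n} → DegreeBelow p (suc n) → coeff p n ≈ 0# → DegreeBelow p n
  DegreeBelow-pred p {n} dp pₙ≈0 j n≤j with ℕ.m≤n⇒m<n∨m≡n n≤j
  ... | inj₁ n<j    = dp j n<j
  ... | inj₂ ≡.refl = pₙ≈0

  DegreeBelow-length : ∀ p → DegreeBelow p (length p)
  DegreeBelow-length []      j _ = refl
  DegreeBelow-length (a ∷ p)   = DegreeBelow-∷ a p (DegreeBelow-length p)

  DegreeBelow-0 : ∀ p → DegreeBelow p 0 → p ≋ []
  DegreeBelow-0 p dp = mk≋ λ j → dp j z≤n

  module Division (D : Pol) (m : ℕ) (D<m+1 : DegreeBelow D (suc m)) (Dₘ≉0 : ¬ coeff D m ≈ 0#) where

    divide : ∀ X → Σ Pol λ q → Σ Pol λ r → DegreeBelow r m × X ≋ q *ₚ D +ₚ r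
    divide []      = [] , [] , (λ _ _ → refl) , ≋-refl
    divide (a ∷ X) with divide X
    ... | q , r , r<m , X≋ = (0# ∷ q) +ₚ (t ∷ []) , r₂ , r₂<m , ≋-trans a∷X≋ (≋-sym rebalance)
      where
      r₁ = a ∷ r
      t = coeff r₁ m * proj₁ (inverse (coeff D m) Dₘ≉0)
      r₂ = r₁ +ₚ (- t) ·ₚ D
      tDₘ≈r₁ₘ : t * coeff D m ≈ coeff r₁ m
      tDₘ≈r₁ₘ = trans (*-assoc _ _ _)
        (trans (*-congˡ (trans (*-comm _ _) (proj₂ (inverse (coeff D m) Dₘ≉0)))) (*-identityʳ _))
      r₂ₘ≈0 : coeff r₂ m ≈ 0#
      r₂ₘ≈0 = begin
        coeff r₂ m                          ≈⟨ coeff-+ₚ r₁ ((- t) ·ₚ D) m ⟩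
        coeff r₁ m + coeff ((- t) ·ₚ D) m   ≈⟨ +-congˡ (coeff-·ₚ (- t) D m) ⟩
        coeff r₁ m + - t * coeff D m        ≈⟨ +-congˡ (-‿distribˡ-* t (coeff D m)) ⟨
        coeff r₁ m + - (t * coeff D m)      ≈⟨ +-congˡ (-‿cong tDₘ≈r₁ₘ) ⟩
        coeff r₁ m + - coeff r₁ m           ≈⟨ -‿inverseʳ _ ⟩
        0#                                  ∎
        where
        open ≈-Reasoning
        open RingProperties ring using (-‿distribˡ-*)
      r₂<m : DegreeBelow r₂ m
      r₂<m = DegreeBelow-pred r₂
        (DegreeBelow-+ₚ r₁ ((- t) ·ₚ D) (DegreeBelow-∷ a r r<m) (DegreeBelow-·ₚ (- t) D D<m+1)) r₂ₘ≈0
      a∷X≋ : a ∷ X ≋ (0# ∷ q) *ₚ D +ₚ r₁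
      a∷X≋ = ≋-trans (∷-cong (sym (+-identityˡ a)) X≋) (≋-sym (+ₚ-congʳ r₁ (0∷-*ₚ q D)))
      rebalance : ((0# ∷ q) +ₚ (t ∷ [])) *ₚ D +ₚ r₂ ≋ (0# ∷ q) *ₚ D +ₚ r₁
      rebalance = begin
        ((0# ∷ q) +ₚ (t ∷ [])) *ₚ D +ₚ (r₁ +ₚ (- t) ·ₚ D)
          ≈⟨ +ₚ-congʳ r₂ (≋-trans (*ₚ-distribʳ D (0# ∷ q) (t ∷ [])) (+ₚ-congˡ ((0# ∷ q) *ₚ D) ([a]*ₚ t D))) ⟩
        ((0# ∷ q) *ₚ D +ₚ t ·ₚ D) +ₚ (r₁ +ₚ (- t) ·ₚ D)
          ≈⟨ +ₚ.interchange ((0# ∷ q) *ₚ D) (t ·ₚ D) r₁ ((- t) ·ₚ D) ⟩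
        ((0# ∷ q) *ₚ D +ₚ r₁) +ₚ (t ·ₚ D +ₚ (- t) ·ₚ D)
          ≈⟨ +ₚ-congˡ ((0# ∷ q) *ₚ D +ₚ r₁) (≋-trans (≋-sym (·ₚ-distribʳ t (- t) D)) (·ₚ-zeroˡ D (-‿inverseʳ t))) ⟩
        ((0# ∷ q) *ₚ D +ₚ r₁) +ₚ []
          ≈⟨ +ₚ-identityʳ _ ⟩
        (0# ∷ q) *ₚ D +ₚ r₁ ∎
        where open ≋-Reasoning

  record CoprimeCofactors (X Y : Pol) : Set (c ⊔ ℓ) where
    field
      g a b u v : Pol
      X≋a*g  : X ≋ a *ₚ g
      Y≋b*g  : Y ≋ b *ₚ g
      bezout : u *ₚ a +ₚ v *ₚ b ≋ 1ₚ

  cofactors-cross : ∀ {X Y} (cf : CoprimeCofactors X Y) →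
    let open CoprimeCofactors cf in a *ₚ Y ≋ b *ₚ X
  cofactors-cross {X} {Y} cf = begin
    a *ₚ Y         ≈⟨ *ₚ-congʳ a Y≋b*g ⟩
    a *ₚ (b *ₚ g)  ≈⟨ *ₚ.x∙yz≈y∙xz a b g ⟩
    b *ₚ (a *ₚ g)  ≈⟨ *ₚ-congʳ b X≋a*g ⟨
    b *ₚ X         ∎
    where
    open CoprimeCofactors cf
    open ≋-Reasoning

  euclid-step : ∀ {X Y q r} → X ≋ q *ₚ Y +ₚ r → CoprimeCofactors Y r → CoprimeCofactors X Y
  euclid-step {X} {Y} {q} {r} X≋ cf = record
    { g = g ; a = q *ₚ a +ₚ b ; b = a ; u = v ; v = u +ₚ -ₚ (v *ₚ q)
    ; X≋a*g = X≋a*g′ ; Y≋b*g = Y≋a*g ; bezout = bezout′ }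
    where
    open CoprimeCofactors cf renaming (X≋a*g to Y≋a*g; Y≋b*g to r≋b*g)
    X≋a*g′ : X ≋ (q *ₚ a +ₚ b) *ₚ g
    X≋a*g′ = begin
      X                               ≈⟨ X≋ ⟩
      q *ₚ Y +ₚ r                     ≈⟨ +ₚ-cong (*ₚ-congʳ q Y≋a*g) r≋b*g ⟩
      q *ₚ (a *ₚ g) +ₚ b *ₚ g         ≈⟨ +ₚ-congʳ (b *ₚ g) (*ₚ-assoc q a g) ⟨
      (q *ₚ a) *ₚ g +ₚ b *ₚ g         ≈⟨ *ₚ-distribʳ g (q *ₚ a) b ⟨
      (q *ₚ a +ₚ b) *ₚ g              ∎
      where open ≋-Reasoning
    T = v *ₚ (q *ₚ a)
    [-vq]a≋-T : (-ₚ (v *ₚ q)) *ₚ a ≋ -ₚ T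
    [-vq]a≋-T = ≋-trans (≋-sym (-ₚ‿distribˡ-*ₚ (v *ₚ q) a)) (-ₚ-cong (*ₚ-assoc v q a))
    bezout′ : v *ₚ (q *ₚ a +ₚ b) +ₚ (u +ₚ -ₚ (v *ₚ q)) *ₚ a ≋ 1ₚ
    bezout′ = begin
      v *ₚ (q *ₚ a +ₚ b) +ₚ (u +ₚ -ₚ (v *ₚ q)) *ₚ a
        ≈⟨ +ₚ-cong (*ₚ-distribˡ v (q *ₚ a) b) (*ₚ-distribʳ a u (-ₚ (v *ₚ q))) ⟩
      (T +ₚ v *ₚ b) +ₚ (u *ₚ a +ₚ (-ₚ (v *ₚ q)) *ₚ a)
        ≈⟨ +ₚ-congˡ (T +ₚ v *ₚ b) (+ₚ-congˡ (u *ₚ a) [-vq]a≋-T) ⟩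
      (T +ₚ v *ₚ b) +ₚ (u *ₚ a +ₚ -ₚ T)
        ≈⟨ +ₚ-congˡ (T +ₚ v *ₚ b) (+ₚ-comm (u *ₚ a) (-ₚ T)) ⟩
      (T +ₚ v *ₚ b) +ₚ (-ₚ T +ₚ u *ₚ a)
        ≈⟨ +ₚ.interchange T (v *ₚ b) (-ₚ T) (u *ₚ a) ⟩
      (T +ₚ -ₚ T) +ₚ (v *ₚ b +ₚ u *ₚ a)
        ≈⟨ +ₚ-cong (-ₚ-inverseʳ T) (+ₚ-comm (v *ₚ b) (u *ₚ a)) ⟩
      u *ₚ a +ₚ v *ₚ b
        ≈⟨ bezout ⟩
      1ₚ ∎
      where open ≋-Reasoning

  coprimeCofactors : ∀ X Y → ¬ ¬ CoprimeCofactors X Y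
  coprimeCofactors X Y = euclid (length Y) X Y (DegreeBelow-length Y)
    where
    euclid : ∀ n X Y → DegreeBelow Y n → ¬ ¬ CoprimeCofactors X Y
    euclid zero    X Y Y<0   = return (record
      { g = X ; a = 1ₚ ; b = [] ; u = 1ₚ ; v = []
      ; X≋a*g = ≋-sym (*ₚ-identityˡ X) ; Y≋b*g = DegreeBelow-0 Y Y<0
      ; bezout = ≋-trans (+ₚ-identityʳ (1ₚ *ₚ 1ₚ)) (*ₚ-identityˡ 1ₚ) })
    euclid (suc m) X Y Y<m+1 = do
      no Yₘ≉0 ← ¬¬-excluded-middle {A = coeff Y m ≈ 0#}
        where yes Yₘ≈0 → euclid m X Y (DegreeBelow-pred Y Y<m+1 Yₘ≈0)
      let (q , r , r<m , X≋) = Division.divide Y m Y<m+1 Yₘ≉0 X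
      cf ← euclid m Y r r<m
      return (euclid-step {q = q} X≋ cf)

module FieldHomomorphism {c ℓ c′ ℓ′} {K : Field c ℓ} {L : Field c′ ℓ′} {ι : Field.Carrier K → Field.Carrier L}
  (hom : Defs.IsFieldHom K L ι) where
  private
    module K = Field K
    module PK = Polynomial K.commutativeRing
  open Field L
  open Polynomial commutativeRing
  open PolynomialMap {R₁ = K.commutativeRing} {R₂ = commutativeRing} hom public
  open RingMorphisms.IsRingHomomorphism hom
  open import Algebra.Definitions.RawSemiring (Semiring.rawSemiring semiring) using (_^_)

  ι-≉0 : ∀ {x} → ¬ x K.≈ K.0# → ¬ ι x ≈ 0#
  ι-≉0 {x} x≉0 ιx≈0 with K.inverse x x≉0
  ... | y , xy≈1 = 1≉0 (begin
    1#          ≈⟨ 1#-homo ⟨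
    ι K.1#      ≈⟨ ⟦⟧-cong xy≈1 ⟨
    ι (x K.* y) ≈⟨ *-homo x y ⟩
    ι x * ι y   ≈⟨ *-congʳ ιx≈0 ⟩
    0# * ι y    ≈⟨ zeroˡ _ ⟩
    0#          ∎)
    where open ≈-Reasoning

  mapₚ-≉[] : ∀ {p} → ¬ p PK.≋ [] → ¬ mapₚ p ≋ []
  mapₚ-≉[] {[]}    p≉0 _ = p≉0 PK.≋-refl
  mapₚ-≉[] {a ∷ p} p≉0 e =
    ι-≉0 (λ a≈0 → mapₚ-≉[] (λ p≋0 → p≉0 (PK.∷-≋[] a≈0 p≋0)) (≋[]-tail e)) (e ! 0)

  CharZero-transfer : Defs.CharZero K → Defs.CharZero L
  CharZero-transfer charZero n N≈0 = ι-≉0 (charZero n) (trans (ι-·ℕ (suc n)) N≈0)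
    where
    ι-·ℕ : ∀ n → ι (Defs._·ℕ_ K n K.1#) ≈ Defs._·ℕ_ L n 1#
    ι-·ℕ zero    = 0#-homo
    ι-·ℕ (suc n) = trans (+-homo _ _) (+-cong 1#-homo (ι-·ℕ n))

  evalMap≡eval-mapₚ : ∀ p x → Defs.evalMap K L ι p x ≡ eval (mapₚ p) x
  evalMap≡eval-mapₚ []      x = ≡.refl
  evalMap≡eval-mapₚ (a ∷ p) x = ≡.cong (λ y → ι a + x * y) (evalMap≡eval-mapₚ p x)

  eval-mapₚ-*ₚ : ∀ p q x → eval (mapₚ (p PK.*ₚ q)) x ≈ eval (mapₚ p) x * eval (mapₚ q) x
  eval-mapₚ-*ₚ p q x = trans (eval-cong x (mapₚ-*ₚ p q)) (eval-*ₚ (mapₚ p) (mapₚ q) x)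

  ^L≡^ : ∀ x n → Defs._^L_ K L x n ≡ x ^ n
  ^L≡^ x zero    = ≡.refl
  ^L≡^ x (suc n) = ≡.cong (x *_) (^L≡^ x n)

module EvaluationInL {c ℓ c′ ℓ′} {K : Field c ℓ} {L : Field c′ ℓ′} {ι : Field.Carrier K → Field.Carrier L}
  (hom : Defs.IsFieldHom K L ι) where
  private
    module K = Field K
    module PK = Polynomial K.commutativeRing
  open Field L hiding (zero)
  open Polynomial commutativeRing
  open FieldProperties L using (Defs-·ℕ≡·ℕ)
  open FieldHomomorphism {K = K} {L = L} hom
  open PolynomialGcd K using (CoprimeCofactors)
  open MahlerOperators K using (∣ₚ⇒≋*ₚ; PolyZero⇒≋[])
  open import Algebra.Definitions.RawSemiring (Semiring.rawSemiring semiring) using (_^_)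
  open import Algebra.Properties.Semiring.Mult semiring using () renaming (_×_ to _·ℕ_)

  eval-mapₚ-PolyZero : ∀ p x → Defs.PolyZero K p → eval (mapₚ p) x ≈ 0#
  eval-mapₚ-PolyZero p x p≈0 = eval-≋[] x (mapₚ-cong (PolyZero⇒≋[] p p≈0))

  ideal-vanishes : ∀ k F d → Defs.IsMahlerDenominator K k F d → ∀ α → Defs.evalMap K L ι d α ≈ 0# →
    ∀ p → Defs.InMahlerIdeal K k F p → eval (mapₚ p) α ≈ 0#
  ideal-vanishes k F d (_ , d∣ideal , _) α d[α]≈0 p p∈ideal with ∣ₚ⇒≋*ₚ {d} {p} (d∣ideal p p∈ideal)
  ... | r , p≋r*d = begin
    eval (mapₚ p) α                 ≈⟨ eval-cong α (mapₚ-cong p≋r*d) ⟩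
    eval (mapₚ (r PK.*ₚ d)) α       ≈⟨ eval-mapₚ-*ₚ r d α ⟩
    eval (mapₚ r) α * eval (mapₚ d) α ≈⟨ *-congˡ (trans (reflexive (≡.sym (evalMap≡eval-mapₚ d α))) d[α]≈0) ⟩
    eval (mapₚ r) α * 0#            ≈⟨ zeroʳ _ ⟩
    0#                              ∎
    where open ≈-Reasoning

  no-common-root : ∀ a b u v α → u PK.*ₚ a PK.+ₚ v PK.*ₚ b PK.≋ PK.1ₚ →
    eval (mapₚ a) α ≈ 0# → eval (mapₚ b) α ≈ 0# → 1# ≈ 0#
  no-common-root a b u v α bezout a[α]≈0 b[α]≈0 = begin
    1#                                                    ≈⟨ eval-mapₚ-1ₚ α ⟨
    eval (mapₚ PK.1ₚ) α                                   ≈⟨ eval-cong α (mapₚ-cong bezout) ⟨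
    eval (mapₚ (u PK.*ₚ a PK.+ₚ v PK.*ₚ b)) α             ≈⟨ eval-cong α (mapₚ-+ₚ (u PK.*ₚ a) (v PK.*ₚ b)) ⟩
    eval (mapₚ (u PK.*ₚ a) +ₚ mapₚ (v PK.*ₚ b)) α         ≈⟨ eval-+ₚ (mapₚ (u PK.*ₚ a)) (mapₚ (v PK.*ₚ b)) α ⟩
    eval (mapₚ (u PK.*ₚ a)) α + eval (mapₚ (v PK.*ₚ b)) α ≈⟨ +-cong (vanish u a a[α]≈0) (vanish v b b[α]≈0) ⟩
    0# + 0#                                               ≈⟨ +-identityˡ 0# ⟩
    0#                                                    ∎
    where
    open ≈-Reasoning
    vanish : ∀ w z → eval (mapₚ z) α ≈ 0# → eval (mapₚ (w PK.*ₚ z)) α ≈ 0#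
    vanish w z z[α]≈0 = trans (eval-mapₚ-*ₚ w z α) (trans (*-congˡ z[α]≈0) (zeroʳ _))

  cofactor-nonvanishing : Defs.CharZero K → ∀ α → ¬ α ≈ 0# → ∀ N′ → Defs._^L_ K L α (suc N′) ≈ α →
    ∀ P Q (cf : CoprimeCofactors (Q PK.*ₚ P PK.∘X^ suc N′) (P PK.*ₚ Q PK.∘X^ suc N′)) →
    ¬ CoprimeCofactors.g cf PK.≋ [] → ¬ eval (mapₚ (CoprimeCofactors.a cf)) α ≈ 0#
  cofactor-nonvanishing charZero α α≉0 N′ αᴺ≈α′ P Q cf g≉0 a[α]≈0 =
    ∼-∘X^ N′ αᴺ≈α N≉0 (mapₚ P) λ P∼P∘ →
    ∼-∘X^ N′ αᴺ≈α N≉0 (mapₚ Q) λ Q∼Q∘ →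
    ∼-common-factor {mapₚ a} {mapₚ b} (∼-resp-≋ ιX≋ιaιg ιY≋ιbιg (∼-*ₚ Q∼Q∘ (∼-sym P∼P∘))) (mapₚ-≉[] g≉0) a[α]≈0
      λ b[α]≈0 → 1≉0 (no-common-root a b u v α bezout a[α]≈0 b[α]≈0)
    where
    open LocalAssociation L α α≉0
    open CoprimeCofactors cf
    N = suc N′
    αᴺ≈α : α ^ N ≈ α
    αᴺ≈α = trans (reflexive (≡.sym (^L≡^ α N))) αᴺ≈α′
    N≉0 : ¬ N ·ℕ 1# ≈ 0#
    N≉0 = CharZero-transfer charZero N′ ∘ trans (reflexive (Defs-·ℕ≡·ℕ N 1#))
    mapₚ-*ₚ∘X^ : ∀ p q → mapₚ (p PK.*ₚ q PK.∘X^ N) ≋ mapₚ p *ₚ mapₚ q ∘X^ N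
    mapₚ-*ₚ∘X^ p q = ≋-trans (mapₚ-*ₚ p (q PK.∘X^ N)) (*ₚ-congʳ (mapₚ p) (mapₚ-∘X^ N q))
    ιX≋ιaιg : mapₚ Q *ₚ mapₚ P ∘X^ N ≋ mapₚ a *ₚ mapₚ g
    ιX≋ιaιg = ≋-trans (≋-sym (mapₚ-*ₚ∘X^ Q P)) (≋-trans (mapₚ-cong X≋a*g) (mapₚ-*ₚ a g))
    ιY≋ιbιg : mapₚ Q ∘X^ N *ₚ mapₚ P ≋ mapₚ b *ₚ mapₚ g
    ιY≋ιbιg = ≋-trans (*ₚ-comm (mapₚ Q ∘X^ N) (mapₚ P))
                (≋-trans (≋-sym (mapₚ-*ₚ∘X^ P Q)) (≋-trans (mapₚ-cong Y≋b*g) (mapₚ-*ₚ b g)))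

module RationalSeries {c ℓ} (K : Field c ℓ) (k : ℕ) (F : Defs.Series K) (P Q : Defs.Poly K)
  (Q₀≉0 : ¬ Field._≈_ K (Defs.coeff K Q 0) (Field.0# K))
  (QF≈P : ∀ n → Field._≈_ K (Defs._⊛_ K Q F n) (Defs.coeff K P n)) where
  open Field K hiding (zero)
  open FieldProperties K
  open Polynomial commutativeRing
  open PowerSeries commutativeRing
  open MahlerOperators K
  open PolynomialGcd K using (CoprimeCofactors; cofactors-cross)

  Q₀≉0′ : ¬ coeff Q 0 ≈ 0#
  Q₀≉0′ Q₀≈0 = Q₀≉0 (trans (reflexive (coeff≗ Q 0)) Q₀≈0)

  QF≐P : Q *ₛ F ≐ coeff P
  QF≐P n = trans (sym (⊛≈*ₛ Q F n)) (trans (QF≈P n) (reflexive (coeff≗ P n)))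

  1ₚ∈ideal : P ≋ [] → Defs.InMahlerIdeal K k F 1ₚ
  1ₚ∈ideal P≋0 = inj₂ ((λ 1ₚ≈0 → 1≉0 (1ₚ≈0 0)) , mahlerEquation-1ₚ k F F≐0)
    where
    F≐0 : F ≐ λ _ → 0#
    F≐0 = *ₛ-cancelˡ Q (λ _ _ → *-cancelˡ-≉0 Q₀≉0′) λ n →
      trans (QF≐P n) (trans (P≋0 ! n) (sym (*ₛ-zeroʳ Q n)))

  cofactor-gcd≉0 : ∀ N′ → ¬ P ≋ [] →
    (cf : CoprimeCofactors (Q *ₚ P ∘X^ suc N′) (P *ₚ Q ∘X^ suc N′)) → ¬ CoprimeCofactors.g cf ≋ []
  cofactor-gcd≉0 N′ P≉0 cf g≋0 = *ₚ∘X^≉[] (suc N′) P Q P≉0 Q₀≉0′ (≋-trans X≋a*g (*ₚ-zeroʳ a g≋0))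
    where open CoprimeCofactors cf

  cofactor∈ideal : ∀ N′ n → suc N′ ≡ k ℕ.^ suc n →
    (cf : CoprimeCofactors (Q *ₚ P ∘X^ suc N′) (P *ₚ Q ∘X^ suc N′)) →
    ¬ Defs.PolyZero K (CoprimeCofactors.a cf) → Defs.InMahlerIdeal K k F (CoprimeCofactors.a cf)
  cofactor∈ideal N′ n N≡kⁿ cf a≉0 = inj₂ (a≉0 , mahlerEquation-single k F {a} {b} n
    (≡.subst (λ N → a *ₛ F ≐ b *ₛ Defs.dilate K N F) N≡kⁿ
      (functional-equation (suc N′) {P} {Q} {a} {b} F Q₀≉0′ QF≐P (cofactors-cross cf))))
    where open CoprimeCofactors cf

open import Data.Nat using (_^_)

proposition4p6 : {c ℓ c' ℓ' : Level} (K : Field c ℓ) → CharZero K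
    → (k : ℕ) → 2 ≤ k
    → (F : Series K) → IsRational K F
    → (d : Poly K) → IsMahlerDenominator K k F d
    → (L : Field c' ℓ') (ι : Field.Carrier K → Field.Carrier L) → IsFieldHom K L ι
    → (α : Field.Carrier L)
    → (∃ λ m → 1 ≤ m × Field._≈_ L (_^L_ K L α m) (Field.1# L))
    → (∃ λ n → 1 ≤ n × Field._≈_ L (_^L_ K L α (k ^ n)) α)
    → ¬ Field._≈_ L (evalMap K L ι d α) (Field.0# L)
proposition4p6 K charZero k@(suc _) (s≤s _) F (P , Q , Q₀≉0 , QF≈P) d isD L ι hom α
               (suc m , _ , αᵐ⁺¹≈1) (suc n , _ , αᵏⁿ≈α) d[α]≈0 =
  ¬¬-excluded-middle {A = P PK.≋ []} λ where
    (yes P≋0) → 1≉0 (trans (sym (eval-mapₚ-1ₚ α)) (vanishes PK.1ₚ (1ₚ∈ideal P≋0)))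
    (no P≉0)  → coprimeCofactors (Q PK.*ₚ P PK.∘X^ suc N′) (P PK.*ₚ Q PK.∘X^ suc N′) λ cf →
      let a[α]≉0 = cofactor-nonvanishing charZero α α≉0 N′ αᴺ≈α P Q cf (cofactor-gcd≉0 N′ P≉0 cf)
          a = CoprimeCofactors.a cf
      in a[α]≉0 (vanishes a (cofactor∈ideal N′ n N≡kⁿ cf (a[α]≉0 ∘ eval-mapₚ-PolyZero a α)))
  where
  open Field L hiding (zero)
  open Polynomial commutativeRing using (eval)
  open FieldHomomorphism {K = K} {L = L} hom using (mapₚ; eval-mapₚ-1ₚ)
  open EvaluationInL {K = K} {L = L} hom
  open RationalSeries K k F P Q Q₀≉0 QF≈P
  open PolynomialGcd K using (CoprimeCofactors; coprimeCofactors)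
  module PK = Polynomial (Field.commutativeRing K)
  vanishes : ∀ p → InMahlerIdeal K k F p → eval (mapₚ p) α ≈ 0#
  vanishes = ideal-vanishes k F d isD α d[α]≈0
  N′ : ℕ
  N′ = ℕ.pred (k ^ suc n)
  N≡kⁿ : suc N′ ≡ k ^ suc n
  N≡kⁿ = ℕ.suc-pred (k ^ suc n) {{ℕ.m^n≢0 k (suc n)}}
  α≉0 : ¬ α ≈ 0#
  α≉0 α≈0 = 1≉0 (trans (sym αᵐ⁺¹≈1) (trans (*-congʳ α≈0) (zeroˡ _)))
  αᴺ≈α : _^L_ K L α (suc N′) ≈ α
  αᴺ≈α = trans (reflexive (≡.cong (_^L_ K L α) N≡kⁿ)) αᵏⁿ≈α
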